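{- For every $n\ge1$, $$\sum_{\pi\in PM_{2n}} q^{\mathrm{i}(\pi)}=q^{\binom{n}{2}}\,[2n-1]_q!!,$$ where $[2n-1]_q!!=\prod_{i=1}^{n}\frac{1-q^{2i-1}}{1-q}$.
   Context: A perfect matching on $[2n]$ is a set partition of $[2n]$ into blocks of size $2$; $PM_{2n}$ is the set of them. A block $\{i<j\}$ is an arc $(i,j)$. The extended arc diagram of $\pi$ consists of the arcs of $\pi$ together with a generalized arc $(-\infty,i)$ for each opener $i$ (the minimum of a block) and a generalized arc $(j,\infty)$ for each closer $j$ (the maximum of a block). Two generalized arcs $(a,b)$ and $(c,d)$ cross if $a<c<b<d$ (with $-\infty$ below and $\infty$ above every integer, and $-\infty<-\infty$, $\infty<\infty$ false). The intertwining number $\mathrm{i}(\pi)$ is the number of crossing pairs of generalized arcs in the extended arc diagram. -}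

module Defs where

open import Data.Nat using (ℕ; zero; suc; _+_; _*_; _^_; _<ᵇ_)
open import Data.Nat.Combinatorics using (_C_)
open import Data.Bool using (Bool; true; false; if_then_else_; _∧_; not)
open import Data.Fin using (Fin; toℕ; _≟_)
open import Data.Vec using (Vec; []; _∷_; lookup)
open import Data.List using (List; []; _∷_; _++_; map; concatMap; upTo; allFin; foldr)
open import Data.Nat.ListAction using (sum; product)
open import Data.Product using (_×_; _,_)
open import Relation.Nullary.Decidable using (⌊_⌋)

allVecs : (m k : ℕ) → List (Vec (Fin k) m)
allVecs zero    k = [] ∷ []
allVecs (suc m) k = concatMap (λ x → map (x ∷_) (allVecs m k)) (allFin k)

allB : {m : ℕ} → (Fin m → Bool) → Bool
allB {m} p = foldr (λ i b → p i ∧ b) true (allFin m)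

-- A perfect matching on [m] is a fixed-point-free involution f : Fin m → Fin m
-- (its blocks are the pairs {i, f i}); stored as the vector of values of f.
isPM : {m : ℕ} → Vec (Fin m) m → Bool
isPM f = allB (λ i → ⌊ lookup f (lookup f i) ≟ i ⌋ ∧ not ⌊ lookup f i ≟ i ⌋)

data Ext : Set where
  -∞  : Ext
  fin : ℕ → Ext
  +∞  : Ext

_<ᵉ_ : Ext → Ext → Bool
-∞    <ᵉ -∞    = false
-∞    <ᵉ _     = true
fin a <ᵉ -∞    = false
fin a <ᵉ fin b = a <ᵇ b
fin a <ᵉ +∞    = true
+∞    <ᵉ _     = false

GArc : Set
GArc = Ext × Ext

crosses : GArc → GArc → Bool
crosses (a , b) (c , d) = (a <ᵉ c) ∧ (c <ᵉ b) ∧ (b <ᵉ d)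

-- Extended arc diagram of a matching f on [m] (positions i : Fin m, value toℕ i):
-- for an opener i (i < f i): the arc (i, f i) and the generalized arc (-∞, i);
-- for a closer j (f j < j): the generalized arc (j, +∞).
extArcs : {m : ℕ} → Vec (Fin m) m → List GArc
extArcs {m} f = concatMap arcsAt (allFin m)
  where
  arcsAt : Fin m → List GArc
  arcsAt i = if toℕ i <ᵇ toℕ (lookup f i)
             then (fin (toℕ i) , fin (toℕ (lookup f i))) ∷ (-∞ , fin (toℕ i)) ∷ []
             else (fin (toℕ i) , +∞) ∷ []

-- number of crossing pairs among a list of generalized arcs
-- (crossing is asymmetric, so counting ordered pairs counts each unordered pair once)
crossCount : List GArc → ℕ
crossCount as = sum (map (λ x → sum (map (λ y → if crosses x y then 1 else 0) as)) as)

intertwining : {m : ℕ} → Vec (Fin m) m → ℕ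
intertwining f = crossCount (extArcs f)

pmGenFun : (m q : ℕ) → ℕ
pmGenFun m q = sum (map (λ f → if isPM f then q ^ intertwining f else 0) (allVecs m m))

-- q-integer [k]_q = 1 + q + ... + q^{k-1} = (1 - q^k)/(1 - q)
qInt : ℕ → ℕ → ℕ
qInt k q = sum (map (q ^_) (upTo k))

-- [2n-1]_q!! = ∏_{i=1}^{n} [2i-1]_q
qDoubleFact : ℕ → ℕ → ℕ
qDoubleFact n q = product (map (λ i → qInt (suc (2 * i)) q) (upTo n))

-- Number positions from 0 and let P(N, h) be the sum of q ^ i(π) over the matchings π of [N] whose
-- first h points are openers. A matching counted by P(2m + 2, c + 1) either opens at c + 1 as well or
-- closes there with a partner a ≤ c. In the latter case deleting the arc (a, c + 1) leaves a matching
-- σ of [2m] whose first c points open, and every pair (a, σ) arises exactly once. The deleted arc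
-- crosses two arcs at each of the a points left of a, three at each of the c - a other earlier
-- points and one at each of the m - c later openers of σ, so i(π) = i(σ) + (c - a) + (c + m) and
--   P(2m + 2, c + 1) = P(2m + 2, c + 2) + q ^ (c + m) [c + 1]_q P(2m, c).
-- Together with P(2m, h) = 0 for h > m this recurrence is solved by
--   P(2 (j + h), h) = q ^ (C(j + h, 2) + C(h, 2)) [1]_q [3]_q ⋯ [2j - 1]_q · [2j + 1]_q ⋯ [2j + h]_q,
-- which at h = 0 is the theorem.

module Submission where

open import Defs
open import Data.Nat using (ℕ; zero; suc; _+_; _*_; _^_; _∸_; _<ᵇ_; _<_; _≤_; z≤n; s≤s; z<s; s≤s⁻¹; pred)
open import Data.Nat.Properties
open import Data.Nat.Combinatorics using (_C_; nCk+nC[k+1]≡[n+1]C[k+1]; nC1≡n)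
open import Data.Nat.ListAction using (sum; product)
open import Data.Nat.ListAction.Properties using (sum-++; sum-↭)
open import Data.Nat.Solver using (module +-*-Solver)
open import Data.Bool using (Bool; true; false; if_then_else_; _∧_; not; T)
open import Data.Bool.Properties using (∧-conicalˡ; ∧-conicalʳ; ∧-identityʳ) renaming (_≟_ to _≟ᵇ_)
import Data.Fin as Fin
open import Data.Fin using (Fin; toℕ; fromℕ<; punchIn; punchOut) renaming (_≟_ to _≟ᶠ_)
open import Data.Fin.Properties using (toℕ<n; toℕ-injective; toℕ-fromℕ<; punchIn-injective; punchInᵢ≢i; punchIn-punchOut)
open import Data.Vec as Vec using (Vec; []; _∷_; lookup; insertAt; tabulate)
open import Data.Vec.Properties
  using (∷-injective; insertAt-lookup; insertAt-punchIn; lookup-map; lookup∘tabulate; tabulate∘lookup; tabulate-cong)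
open import Data.List using (List; []; _∷_; map; filter; foldr; concatMap; upTo; applyUpTo; allFin)
open import Data.List.Properties using (map-++; map-∘; map-cong; map-tabulate)
open import Data.List.Membership.Propositional using (_∈_; lose; find)
open import Data.List.Membership.Propositional.Properties
  using (∈-map⁺; ∈-map⁻; ∈-filter⁺; ∈-filter⁻; ∈-concatMap⁺; ∈-concatMap⁻; ∈-allFin; ∈-upTo⁺; ∈-upTo⁻)
open import Data.List.Membership.Propositional.Properties.WithK using (unique∧set⇒bag)
open import Data.List.Relation.Binary.BagAndSetEquality using (∼bag⇒↭)
open import Data.List.Relation.Binary.Disjoint.Propositional using (Disjoint)
import Data.List.Relation.Binary.Permutation.Propositional.Properties as Perm
open import Data.List.Relation.Unary.Any using (here; there)
import Data.List.Relation.Unary.All as All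
import Data.List.Relation.Unary.All.Properties as All
open import Data.List.Relation.Unary.AllPairs using ([]; _∷_)
open import Data.List.Relation.Unary.Unique.Propositional using (Unique)
import Data.List.Relation.Unary.Unique.Propositional.Properties as Unique
open import Data.Product using (_×_; _,_; ∃; proj₁; proj₂; uncurry)
open import Data.Sum using (_⊎_; inj₁; inj₂)
open import Data.Empty using (⊥-elim)
open import Function using (_∘_)
open import Function.Bundles using (mk⇔)
open import Relation.Binary.Definitions using (tri<; tri≈; tri>)
open import Relation.Binary.PropositionalEquality
open import Relation.Nullary using (Dec; yes; no)
open import Relation.Nullary.Decidable using (⌊_⌋)

open +-*-Solver

sumBelow : ℕ → (ℕ → ℕ) → ℕ
sumBelow zero    F = 0
sumBelow (suc m) F = F 0 + sumBelow m (F ∘ suc)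

syntax sumBelow m (λ i → e) = ∑[ i < m ] e

sumBelow-cong : ∀ m {F G : ℕ → ℕ} → (∀ i → i < m → F i ≡ G i) → sumBelow m F ≡ sumBelow m G
sumBelow-cong zero    F≡G = refl
sumBelow-cong (suc m) F≡G = cong₂ _+_ (F≡G 0 z<s) (sumBelow-cong m (λ i i<m → F≡G (suc i) (s≤s i<m)))

sumBelow-distrib-+ : ∀ m (F G : ℕ → ℕ) → ∑[ i < m ] (F i + G i) ≡ sumBelow m F + sumBelow m G
sumBelow-distrib-+ zero    F G = refl
sumBelow-distrib-+ (suc m) F G = begin
  F 0 + G 0 + ∑[ i < m ] (F (suc i) + G (suc i))
    ≡⟨ cong (F 0 + G 0 +_) (sumBelow-distrib-+ m (F ∘ suc) (G ∘ suc)) ⟩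
  F 0 + G 0 + (sumBelow m (F ∘ suc) + sumBelow m (G ∘ suc))
    ≡⟨ solve 4 (λ a b c d → a :+ b :+ (c :+ d) := a :+ c :+ (b :+ d)) refl (F 0) (G 0) _ _ ⟩
  F 0 + sumBelow m (F ∘ suc) + (G 0 + sumBelow m (G ∘ suc)) ∎
  where open ≡-Reasoning

sumBelow-split : ∀ k l (F : ℕ → ℕ) → sumBelow (k + l) F ≡ sumBelow k F + ∑[ i < l ] F (k + i)
sumBelow-split zero    l F = refl
sumBelow-split (suc k) l F = trans (cong (F 0 +_) (sumBelow-split k l (F ∘ suc))) (sym (+-assoc (F 0) _ _))

sumBelow-const : ∀ m c → ∑[ i < m ] c ≡ m * c
sumBelow-const zero    c = refl
sumBelow-const (suc m) c = cong (c +_) (sumBelow-const m c)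

sumBelow-*ˡ : ∀ m c (F : ℕ → ℕ) → ∑[ i < m ] (c * F i) ≡ c * sumBelow m F
sumBelow-*ˡ zero    c F = sym (*-zeroʳ c)
sumBelow-*ˡ (suc m) c F = trans (cong (c * F 0 +_) (sumBelow-*ˡ m c (F ∘ suc))) (sym (*-distribˡ-+ c (F 0) _))

sumBelow-suc : ∀ k (F : ℕ → ℕ) → sumBelow (suc k) F ≡ sumBelow k F + F k
sumBelow-suc zero    F = +-comm (F 0) 0
sumBelow-suc (suc k) F = trans (cong (F 0 +_) (sumBelow-suc k (F ∘ suc))) (sym (+-assoc (F 0) _ _))

sumBelow-reverse : ∀ c (F : ℕ → ℕ) → ∑[ a < suc c ] F (c ∸ a) ≡ sumBelow (suc c) F
sumBelow-reverse zero    F = refl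
sumBelow-reverse (suc c) F =
  trans (cong (F (suc c) +_) (sumBelow-reverse c F))
        (trans (+-comm (F (suc c)) _) (sym (sumBelow-suc (suc c) F)))

sum-applyUpTo : ∀ m (f F : ℕ → ℕ) → sum (map F (applyUpTo f m)) ≡ ∑[ i < m ] F (f i)
sum-applyUpTo zero    f F = refl
sum-applyUpTo (suc m) f F = cong (F (f 0) +_) (sum-applyUpTo m (f ∘ suc) F)

sum-upTo : ∀ m (F : ℕ → ℕ) → sum (map F (upTo m)) ≡ sumBelow m F
sum-upTo m = sum-applyUpTo m (λ i → i)

sum-allFin : ∀ m (F : Fin m → ℕ) (G : ℕ → ℕ) → (∀ i → F i ≡ G (toℕ i)) →
             sum (map F (allFin m)) ≡ sumBelow m G
sum-allFin zero    F G F≡G = refl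
sum-allFin (suc m) F G F≡G =
  cong₂ _+_ (F≡G Fin.zero)
    (trans (cong sum (trans (map-tabulate Fin.suc F) (sym (map-tabulate (λ i → i) (F ∘ Fin.suc)))))
           (sum-allFin m (F ∘ Fin.suc) (G ∘ suc) (F≡G ∘ Fin.suc)))

sum-map-cong : {A : Set} {F G : A → ℕ} (xs : List A) → (∀ x → F x ≡ G x) → sum (map F xs) ≡ sum (map G xs)
sum-map-cong xs F≡G = cong sum (map-cong F≡G xs)

sum-map-+ : {A : Set} (F G : A → ℕ) (xs : List A) →
            sum (map (λ x → F x + G x) xs) ≡ sum (map F xs) + sum (map G xs)
sum-map-+ F G []       = refl
sum-map-+ F G (x ∷ xs) =
  trans (cong (F x + G x +_) (sum-map-+ F G xs))
        (solve 4 (λ a b c d → a :+ b :+ (c :+ d) := a :+ c :+ (b :+ d)) refl (F x) (G x) _ _)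

sum-map-*ˡ : {A : Set} (c : ℕ) (F : A → ℕ) (xs : List A) → sum (map (λ x → c * F x) xs) ≡ c * sum (map F xs)
sum-map-*ˡ c F []       = sym (*-zeroʳ c)
sum-map-*ˡ c F (x ∷ xs) = trans (cong (c * F x +_) (sum-map-*ˡ c F xs)) (sym (*-distribˡ-+ c (F x) _))

sum-map-zero : {A : Set} (F : A → ℕ) (xs : List A) → (∀ x → F x ≡ 0) → sum (map F xs) ≡ 0
sum-map-zero F []       F≡0 = refl
sum-map-zero F (x ∷ xs) F≡0 = cong₂ _+_ (F≡0 x) (sum-map-zero F xs F≡0)

sum-concatMap : {A B : Set} (F : B → ℕ) (h : A → List B) (xs : List A) →
                sum (map F (concatMap h xs)) ≡ sum (map (λ x → sum (map F (h x))) xs)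
sum-concatMap F h []       = refl
sum-concatMap F h (x ∷ xs) =
  trans (cong sum (map-++ F (h x) (concatMap h xs)))
        (trans (sum-++ (map F (h x)) _) (cong (sum (map F (h x)) +_) (sum-concatMap F h xs)))

sum-map-comm : {A B : Set} (G : A → B → ℕ) (xs : List A) (ys : List B) →
               sum (map (λ a → sum (map (G a) ys)) xs) ≡ sum (map (λ b → sum (map (λ a → G a b) xs)) ys)
sum-map-comm G []       ys = sym (sum-map-zero (λ _ → 0) ys (λ _ → refl))
sum-map-comm G (x ∷ xs) ys =
  trans (cong (sum (map (G x) ys) +_) (sum-map-comm G xs ys))
        (sym (sum-map-+ (G x) (λ b → sum (map (λ a → G a b) xs)) ys))

sumWhen : {A : Set} → (A → Bool) → (A → ℕ) → List A → ℕ
sumWhen P g xs = sum (map (λ x → if P x then g x else 0) xs)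

module _ {A : Set} (P : A → Bool) where

  holds? : (x : A) → Dec (P x ≡ true)
  holds? x = P x ≟ᵇ true

  sumWhen≡sum-filter : (g : A → ℕ) (xs : List A) → sumWhen P g xs ≡ sum (map g (filter holds? xs))
  sumWhen≡sum-filter g []       = refl
  sumWhen≡sum-filter g (x ∷ xs) with P x
  ... | true  = cong (g x +_) (sumWhen≡sum-filter g xs)
  ... | false = sumWhen≡sum-filter g xs

Unique-map-injectiveOn : {A B : Set} (R : B → Set) (φ : B → A) →
  (∀ {y₁ y₂} → R y₁ → R y₂ → φ y₁ ≡ φ y₂ → y₁ ≡ y₂) →
  (ys : List B) → (∀ {y} → y ∈ ys → R y) → Unique ys → Unique (map φ ys)
Unique-map-injectiveOn R φ inj []       _   []         = []
Unique-map-injectiveOn R φ inj (y ∷ ys) Rys (y∉ ∷ uys) =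
  All.map⁺ (All.tabulate (λ z∈ φy≡φz → All.lookup y∉ z∈ (inj (Rys (here refl)) (Rys (there z∈)) φy≡φz)))
  ∷ Unique-map-injectiveOn R φ inj ys (Rys ∘ there) uys

sumWhen-bijection : {A B : Set} (xs : List A) (ys : List B) (P : A → Bool) (Q : B → Bool)
  (φ : B → A) (g : A → ℕ) → Unique xs → Unique ys →
  (∀ {y} → y ∈ ys → Q y ≡ true → φ y ∈ xs × P (φ y) ≡ true) →
  (∀ {y₁ y₂} → y₁ ∈ ys × Q y₁ ≡ true → y₂ ∈ ys × Q y₂ ≡ true → φ y₁ ≡ φ y₂ → y₁ ≡ y₂) →
  (∀ {x} → x ∈ xs → P x ≡ true → ∃ λ y → y ∈ ys × Q y ≡ true × φ y ≡ x) →
  sumWhen P g xs ≡ sumWhen Q (g ∘ φ) ys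
sumWhen-bijection {A} {B} xs ys P Q φ g uxs uys into inj onto = begin
  sumWhen P g xs                ≡⟨ sumWhen≡sum-filter P g xs ⟩
  sum (map g (filter (holds? P) xs))
    ≡⟨ sum-↭ (Perm.map⁺ g (∼bag⇒↭ (unique∧set⇒bag uxs′ uys′ (mk⇔ to from)))) ⟩
  sum (map g (map φ ys′))       ≡⟨ cong sum (sym (map-∘ ys′)) ⟩
  sum (map (g ∘ φ) ys′)         ≡⟨ sym (sumWhen≡sum-filter Q (g ∘ φ) ys) ⟩
  sumWhen Q (g ∘ φ) ys ∎
  where
  open ≡-Reasoning
  ys′ : List B
  ys′ = filter (holds? Q) ys
  uxs′ : Unique (filter (holds? P) xs)
  uxs′ = Unique.filter⁺ (holds? P) uxs
  uys′ : Unique (map φ ys′)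
  uys′ = Unique-map-injectiveOn (λ y → y ∈ ys × Q y ≡ true) φ inj ys′ (∈-filter⁻ (holds? Q))
                                (Unique.filter⁺ (holds? Q) uys)
  to : ∀ {x} → x ∈ filter (holds? P) xs → x ∈ map φ ys′
  to x∈ with ∈-filter⁻ (holds? P) x∈
  ... | x∈xs , Px with onto x∈xs Px
  ...   | y , y∈ys , Qy , refl = ∈-map⁺ φ (∈-filter⁺ (holds? Q) y∈ys Qy)
  from : ∀ {x} → x ∈ map φ ys′ → x ∈ filter (holds? P) xs
  from x∈ with ∈-map⁻ φ x∈
  ... | y , y∈ys′ , refl with ∈-filter⁻ (holds? Q) y∈ys′
  ...   | y∈ys , Qy = uncurry (∈-filter⁺ (holds? P)) (into y∈ys Qy)

Unique-concatMap : {A B : Set} (f : A → List B) (xs : List A) → Unique xs → (∀ x → Unique (f x)) →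
                   (∀ {x y b} → b ∈ f x → b ∈ f y → x ≡ y) → Unique (concatMap f xs)
Unique-concatMap f []       []         uf disj = []
Unique-concatMap f (x ∷ xs) (x∉ ∷ uxs) uf disj = Unique.++⁺ (uf x) (Unique-concatMap f xs uxs uf disj) fx#rest
  where
  fx#rest : Disjoint (f x) (concatMap f xs)
  fx#rest (b∈fx , b∈rest) with find (∈-concatMap⁻ f b∈rest)
  ... | y , y∈xs , b∈fy = All.lookup x∉ y∈xs (disj b∈fx b∈fy)

∈-allVecs : ∀ m k (v : Vec (Fin k) m) → v ∈ allVecs m k
∈-allVecs zero    k []      = here refl
∈-allVecs (suc m) k (x ∷ v) = ∈-concatMap⁺ _ (lose (∈-allFin x) (∈-map⁺ (x ∷_) (∈-allVecs m k v)))

Unique-allVecs : ∀ m k → Unique (allVecs m k)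
Unique-allVecs zero    k = All.[] ∷ []
Unique-allVecs (suc m) k =
  Unique-concatMap _ (allFin k) (Unique.allFin⁺ k)
    (λ x → Unique.map⁺ (proj₂ ∘ ∷-injective) (Unique-allVecs m k)) heads≡
  where
  heads≡ : ∀ {x y v} → v ∈ map (x ∷_) (allVecs m k) → v ∈ map (y ∷_) (allVecs m k) → x ≡ y
  heads≡ v∈x v∈y with ∈-map⁻ _ v∈x | ∈-map⁻ _ v∈y
  ... | _ , _ , refl | _ , _ , x∷u≡y∷w = proj₁ (∷-injective x∷u≡y∷w)

-- Out of range the value is the junk 0.
lookupℕ : {k m : ℕ} → Vec (Fin k) m → ℕ → ℕ
lookupℕ []      _       = 0
lookupℕ (a ∷ v) zero    = toℕ a
lookupℕ (a ∷ v) (suc x) = lookupℕ v x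

lookupℕ-toℕ : {k m : ℕ} (v : Vec (Fin k) m) (i : Fin m) → lookupℕ v (toℕ i) ≡ toℕ (lookup v i)
lookupℕ-toℕ (a ∷ v) Fin.zero    = refl
lookupℕ-toℕ (a ∷ v) (Fin.suc i) = lookupℕ-toℕ v i

lookupℕ-< : {k m : ℕ} (v : Vec (Fin k) m) → ∀ x → x < m → lookupℕ v x < k
lookupℕ-< v x x<m =
  subst (_< _) (trans (sym (lookupℕ-toℕ v (fromℕ< x<m))) (cong (lookupℕ v) (toℕ-fromℕ< x<m))) (toℕ<n _)

lookupℕ-≥ : {k m : ℕ} (v : Vec (Fin k) m) → ∀ x → m ≤ x → lookupℕ v x ≡ 0
lookupℕ-≥ []      x       _         = refl
lookupℕ-≥ (a ∷ v) (suc x) (s≤s m≤x) = lookupℕ-≥ v x m≤x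

Vec-ext : {A : Set} {m : ℕ} (u v : Vec A m) → (∀ i → lookup u i ≡ lookup v i) → u ≡ v
Vec-ext u v u≗v = trans (sym (tabulate∘lookup u)) (trans (tabulate-cong u≗v) (tabulate∘lookup v))

-- The intertwining number as a double sum over positions

indicator : Bool → ℕ
indicator b = if b then 1 else 0

crossings : List GArc → List GArc → ℕ
crossings as bs = sum (map (λ α → sum (map (λ β → indicator (crosses α β)) bs)) as)

crossings-concatMap : {A : Set} (h : A → List GArc) (xs : List A) →
  crossings (concatMap h xs) (concatMap h xs) ≡ sum (map (λ x → sum (map (λ y → crossings (h x) (h y)) xs)) xs)
crossings-concatMap h xs =
  trans (sum-concatMap (λ α → sum (map (λ β → indicator (crosses α β)) (concatMap h xs))) h xs)
        (sum-map-cong xs (λ x →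
          trans (sum-map-cong (h x) (λ α → sum-concatMap (λ β → indicator (crosses α β)) h xs))
                (sum-map-comm (λ α y → sum (map (λ β → indicator (crosses α β)) (h y))) (h x) xs)))

arcsAt : ℕ → ℕ → List GArc
arcsAt x X = if x <ᵇ X then (fin x , fin X) ∷ (-∞ , fin x) ∷ [] else (fin x , +∞) ∷ []

crossingsBetween : ℕ → ℕ → ℕ → ℕ → ℕ
crossingsBetween x X y Y = crossings (arcsAt x X) (arcsAt y Y)

intertwining≡∑∑crossingsBetween : {m : ℕ} (f : Vec (Fin m) m) →
  intertwining f ≡ ∑[ x < m ] ∑[ y < m ] crossingsBetween x (lookupℕ f x) y (lookupℕ f y)
intertwining≡∑∑crossingsBetween {m} f =
  trans (crossings-concatMap (λ i → arcsAt (toℕ i) (toℕ (lookup f i))) (allFin m))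
        (sum-allFin m _ _ (λ i → sum-allFin m _ _ (λ j →
          cong₂ (λ X Y → crossingsBetween (toℕ i) X (toℕ j) Y) (sym (lookupℕ-toℕ f i)) (sym (lookupℕ-toℕ f j)))))

<ᵇ-true : ∀ {m n} → m < n → (m <ᵇ n) ≡ true
<ᵇ-true {m} {n} m<n with m <ᵇ n | <⇒<ᵇ m<n
... | true | _ = refl

<ᵇ-false : ∀ {m n} → n ≤ m → (m <ᵇ n) ≡ false
<ᵇ-false {m} {n} n≤m with m <ᵇ n in eq
... | false = refl
... | true  = ⊥-elim (<⇒≱ (<ᵇ⇒< m n (subst T (sym eq) _)) n≤m)

<ᵇ-true⁻¹ : ∀ {m n} → (m <ᵇ n) ≡ true → m < n
<ᵇ-true⁻¹ {m} {n} eq = <ᵇ⇒< m n (subst T (sym eq) _)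

module OrderEmbedding (e : ℕ → ℕ) (e-<ᵇ : ∀ u v → (e u <ᵇ e v) ≡ (u <ᵇ v)) where

  liftExt : Ext → Ext
  liftExt -∞      = -∞
  liftExt (fin a) = fin (e a)
  liftExt +∞      = +∞

  liftArc : GArc → GArc
  liftArc (u , v) = liftExt u , liftExt v

  liftExt-<ᵉ : ∀ u v → (liftExt u <ᵉ liftExt v) ≡ (u <ᵉ v)
  liftExt-<ᵉ -∞      -∞      = refl
  liftExt-<ᵉ -∞      (fin x) = refl
  liftExt-<ᵉ -∞      +∞      = refl
  liftExt-<ᵉ (fin a) -∞      = refl
  liftExt-<ᵉ (fin a) (fin b) = e-<ᵇ a b
  liftExt-<ᵉ (fin a) +∞      = refl
  liftExt-<ᵉ +∞      v       = refl

  crosses-liftArc : ∀ α β → crosses (liftArc α) (liftArc β) ≡ crosses α β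
  crosses-liftArc (a , b) (c , d) rewrite liftExt-<ᵉ a c | liftExt-<ᵉ c b | liftExt-<ᵉ b d = refl

  arcsAt-embed : ∀ x X → arcsAt (e x) (e X) ≡ map liftArc (arcsAt x X)
  arcsAt-embed x X rewrite e-<ᵇ x X with x <ᵇ X
  ... | true  = refl
  ... | false = refl

  crossingsBetween-embed : ∀ x X y Y → crossingsBetween (e x) (e X) (e y) (e Y) ≡ crossingsBetween x X y Y
  crossingsBetween-embed x X y Y rewrite arcsAt-embed x X | arcsAt-embed y Y =
    trans (cong sum (sym (map-∘ (arcsAt x X))))
          (sum-map-cong (arcsAt x X) (λ α →
            trans (cong sum (sym (map-∘ (arcsAt y Y))))
                  (sum-map-cong (arcsAt y Y) (λ β → cong indicator (crosses-liftArc α β)))))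

crossingsWithArc : ℕ → ℕ → ℕ → ℕ → ℕ
crossingsWithArc a h x X =
  crossingsBetween a h x X + crossingsBetween x X a h + crossingsBetween x X h a + crossingsBetween h a x X

crossingsWithArc-value : ∀ a h x X → a < h → x ≢ a → x ≢ h → (x < h → h < X) →
  crossingsWithArc a h x X ≡ (if x <ᵇ h then (if a <ᵇ x then 3 else 2) else indicator (x <ᵇ X))
crossingsWithArc-value a h x X a<h x≢a x≢h opener with <-cmp x h
... | tri≈ _ x≡h _ = ⊥-elim (x≢h x≡h)
... | tri< x<h _ _ with opener x<h | <-cmp a x
...   | h<X | tri< a<x _ _
        rewrite <ᵇ-true a<h | <ᵇ-false (<⇒≤ a<h) | <ᵇ-true (<-trans x<h h<X)
              | <ᵇ-true a<x | <ᵇ-true x<h | <ᵇ-true h<X | <ᵇ-false (<⇒≤ a<x)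
              | <ᵇ-false (<⇒≤ x<h) = refl
...   | h<X | tri≈ _ a≡x _ = ⊥-elim (x≢a (sym a≡x))
...   | h<X | tri> _ _ x<a
        rewrite <ᵇ-true a<h | <ᵇ-false (<⇒≤ a<h) | <ᵇ-true (<-trans x<h h<X)
              | <ᵇ-false (<⇒≤ x<a) | <ᵇ-true x<h | <ᵇ-true h<X | <ᵇ-true x<a
              | <ᵇ-true (<-trans a<h h<X) | <ᵇ-false (<⇒≤ h<X)
              | <ᵇ-false (<⇒≤ x<h) = refl
crossingsWithArc-value a h x X a<h x≢a x≢h opener | tri> _ _ h<x with <-cmp x X
... | tri< x<X _ _
    rewrite <ᵇ-true a<h | <ᵇ-false (<⇒≤ a<h) | <ᵇ-true x<X | <ᵇ-false (<⇒≤ h<x)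
          | <ᵇ-true h<x | <ᵇ-true (<-trans a<h h<x) | <ᵇ-false (<⇒≤ (<-trans a<h h<x)) = refl
... | tri≈ _ refl _
    rewrite <ᵇ-true a<h | <ᵇ-false (<⇒≤ a<h) | <ᵇ-false (≤-refl {x}) | <ᵇ-false (<⇒≤ h<x)
          | <ᵇ-true h<x | <ᵇ-true (<-trans a<h h<x) | <ᵇ-false (<⇒≤ (<-trans a<h h<x)) = refl
... | tri> _ _ X<x
    rewrite <ᵇ-true a<h | <ᵇ-false (<⇒≤ a<h) | <ᵇ-false (<⇒≤ X<x) | <ᵇ-false (<⇒≤ h<x)
          | <ᵇ-true h<x | <ᵇ-true (<-trans a<h h<x) | <ᵇ-false (<⇒≤ (<-trans a<h h<x)) = refl

crossingsWithArc-self : ∀ a h → a < h →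
  crossingsBetween a h a h + crossingsBetween a h h a + crossingsBetween h a a h + crossingsBetween h a h a ≡ 0
crossingsWithArc-self a h a<h
  rewrite <ᵇ-true a<h | <ᵇ-false (<⇒≤ a<h) | <ᵇ-false (≤-refl {a}) | <ᵇ-false (≤-refl {h})
        | <ᵇ-true a<h | <ᵇ-false (<⇒≤ a<h) = refl

skip : ℕ → ℕ → ℕ
skip zero    p       = suc p
skip (suc c) zero    = zero
skip (suc c) (suc p) = suc (skip c p)

unskip : ℕ → ℕ → ℕ
unskip zero    x       = pred x
unskip (suc c) zero    = zero
unskip (suc c) (suc x) = suc (unskip c x)

toℕ-punchIn : ∀ {n} (i : Fin (suc n)) (j : Fin n) → toℕ (punchIn i j) ≡ skip (toℕ i) (toℕ j)
toℕ-punchIn Fin.zero    j           = refl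
toℕ-punchIn (Fin.suc i) Fin.zero    = refl
toℕ-punchIn (Fin.suc i) (Fin.suc j) = cong suc (toℕ-punchIn i j)

skip-<ᵇ : ∀ c u v → (skip c u <ᵇ skip c v) ≡ (u <ᵇ v)
skip-<ᵇ zero    u       v       = refl
skip-<ᵇ (suc c) zero    zero    = refl
skip-<ᵇ (suc c) zero    (suc v) = refl
skip-<ᵇ (suc c) (suc u) zero    = refl
skip-<ᵇ (suc c) (suc u) (suc v) = skip-<ᵇ c u v

skip-<ᵇ-self : ∀ c p → (skip c p <ᵇ c) ≡ (p <ᵇ c)
skip-<ᵇ-self zero    p       = refl
skip-<ᵇ-self (suc c) zero    = refl
skip-<ᵇ-self (suc c) (suc p) = skip-<ᵇ-self c p

skip-below : ∀ {c p} → p < c → skip c p ≡ p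
skip-below {suc c} {zero}  _         = refl
skip-below {suc c} {suc p} (s≤s p<c) = cong suc (skip-below p<c)

skip-above : ∀ {c p} → c ≤ p → skip c p ≡ suc p
skip-above {zero}          _         = refl
skip-above {suc c} {suc p} (s≤s c≤p) = cong suc (skip-above c≤p)

skip-≥ : ∀ c p → p ≤ skip c p
skip-≥ zero    p       = n≤1+n p
skip-≥ (suc c) zero    = z≤n
skip-≥ (suc c) (suc p) = s≤s (skip-≥ c p)

skip-≢ : ∀ c p → skip c p ≢ c
skip-≢ zero    p       ()
skip-≢ (suc c) zero    ()
skip-≢ (suc c) (suc p) eq = skip-≢ c p (suc-injective eq)

skip-< : ∀ c {p K} → p < K → skip c p < suc K
skip-< zero            p<K       = s≤s p<K
skip-< (suc c) {zero}  p<K       = s≤s z≤n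
skip-< (suc c) {suc p} {suc K} (s≤s p<K) = s≤s (skip-< c p<K)

unskip-skip : ∀ c p → unskip c (skip c p) ≡ p
unskip-skip zero    p       = refl
unskip-skip (suc c) zero    = refl
unskip-skip (suc c) (suc p) = cong suc (unskip-skip c p)

skip-injective : ∀ c {u v} → skip c u ≡ skip c v → u ≡ v
skip-injective c {u} {v} eq = trans (sym (unskip-skip c u)) (trans (cong (unskip c) eq) (unskip-skip c v))

skip-unskip : ∀ c x → x ≢ c → skip c (unskip c x) ≡ x
skip-unskip zero    zero    x≢c = ⊥-elim (x≢c refl)
skip-unskip zero    (suc x) x≢c = refl
skip-unskip (suc c) zero    x≢c = refl
skip-unskip (suc c) (suc x) x≢c = cong suc (skip-unskip c x (x≢c ∘ cong suc))

unskip-< : ∀ c x K → c ≤ K → x < suc K → x ≢ c → unskip c x < K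
unskip-< zero    zero    K       _         _         x≢c = ⊥-elim (x≢c refl)
unskip-< zero    (suc x) K       _         (s≤s x<K) x≢c = x<K
unskip-< (suc c) zero    (suc K) _         _         _   = s≤s z≤n
unskip-< (suc c) (suc x) (suc K) (s≤s c≤K) (s≤s x<K) x≢c = s≤s (unskip-< c x K c≤K x<K (x≢c ∘ cong suc))

skip-view : ∀ c x K → c ≤ K → x < suc K → (x ≡ c) ⊎ (∃ λ y → y < K × skip c y ≡ x)
skip-view c x K c≤K x<1+K with x ≟ c
... | yes x≡c = inj₁ x≡c
... | no  x≢c = inj₂ (unskip c x , unskip-< c x K c≤K x<1+K x≢c , skip-unskip c x x≢c)

punchIn-view : ∀ {n} (k i : Fin (suc n)) → (i ≡ k) ⊎ (∃ λ j → i ≡ punchIn k j)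
punchIn-view k i with k ≟ᶠ i
... | yes k≡i = inj₁ (sym k≡i)
... | no  k≢i = inj₂ (punchOut k≢i , sym (punchIn-punchOut k≢i))

-- Saturates at n, so that positions can be given as plain numbers.
clamp : (n : ℕ) → ℕ → Fin (suc n)
clamp zero    _       = Fin.zero
clamp (suc n) zero    = Fin.zero
clamp (suc n) (suc k) = Fin.suc (clamp n k)

toℕ-clamp : ∀ n k → k ≤ n → toℕ (clamp n k) ≡ k
toℕ-clamp zero    zero    _         = refl
toℕ-clamp (suc n) zero    _         = refl
toℕ-clamp (suc n) (suc k) (s≤s k≤n) = cong suc (toℕ-clamp n k k≤n)

IsMatching : {m : ℕ} → Vec (Fin m) m → Set
IsMatching {m} f = ∀ (i : Fin m) → (lookup f (lookup f i) ≡ i) × (lookup f i ≢ i)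

module _ {A : Set} (p : A → Bool) where

  foldr-∧-true⁻¹ : (xs : List A) → foldr (λ i b → p i ∧ b) true xs ≡ true → ∀ {x} → x ∈ xs → p x ≡ true
  foldr-∧-true⁻¹ (y ∷ xs) eq (here refl) = ∧-conicalˡ (p y) _ eq
  foldr-∧-true⁻¹ (y ∷ xs) eq (there x∈) = foldr-∧-true⁻¹ xs (∧-conicalʳ (p y) _ eq) x∈

  foldr-∧-true : (xs : List A) → (∀ x → p x ≡ true) → foldr (λ i b → p i ∧ b) true xs ≡ true
  foldr-∧-true []       _  = refl
  foldr-∧-true (y ∷ xs) py = cong₂ _∧_ (py y) (foldr-∧-true xs py)

isPM⇒IsMatching : {m : ℕ} (f : Vec (Fin m) m) → isPM f ≡ true → IsMatching f
isPM⇒IsMatching {m} f isPMf i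
  with lookup f (lookup f i) ≟ᶠ i | lookup f i ≟ᶠ i | foldr-∧-true⁻¹ _ (allFin m) isPMf (∈-allFin i)
... | yes ff≡i | no f≢i | _  = ff≡i , f≢i
... | no _     | _      | ()
... | yes _    | yes _  | ()

IsMatching⇒isPM : {m : ℕ} (f : Vec (Fin m) m) → IsMatching f → isPM f ≡ true
IsMatching⇒isPM {m} f matching = foldr-∧-true _ (allFin m) checkAt
  where
  checkAt : ∀ i → (⌊ lookup f (lookup f i) ≟ᶠ i ⌋ ∧ not ⌊ lookup f i ≟ᶠ i ⌋) ≡ true
  checkAt i with lookup f (lookup f i) ≟ᶠ i | lookup f i ≟ᶠ i
  ... | yes _     | no _     = refl
  ... | no ff≢i   | _        = ⊥-elim (ff≢i (proj₁ (matching i)))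
  ... | yes _     | yes f≡i  = ⊥-elim (proj₂ (matching i) f≡i)

allBelow : ℕ → (ℕ → Bool) → Bool
allBelow zero    p = true
allBelow (suc k) p = allBelow k p ∧ p k

allBelow⁻¹ : ∀ k p → allBelow k p ≡ true → ∀ x → x < k → p x ≡ true
allBelow⁻¹ (suc k) p eq x x<1+k with m≤n⇒m<n∨m≡n (s≤s⁻¹ x<1+k)
... | inj₁ x<k  = allBelow⁻¹ k p (∧-conicalˡ (allBelow k p) _ eq) x x<k
... | inj₂ refl = ∧-conicalʳ (allBelow k p) _ eq

allBelow-intro : ∀ k p → (∀ x → x < k → p x ≡ true) → allBelow k p ≡ true
allBelow-intro zero    p _  = refl
allBelow-intro (suc k) p px = cong₂ _∧_ (allBelow-intro k p (λ x x<k → px x (m<n⇒m<1+n x<k))) (px k ≤-refl)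

openersBelow : {m : ℕ} → ℕ → Vec (Fin m) m → Bool
openersBelow h v = allBelow h (λ x → x <ᵇ lookupℕ v x)

+-double-injective : ∀ a b → a + a ≡ b + b → a ≡ b
+-double-injective zero    zero    _  = refl
+-double-injective (suc a) (suc b) eq =
  cong suc (+-double-injective a b (suc-injective (trans (sym (+-suc a a)) (trans (suc-injective eq) (+-suc b b)))))

module Involution {m : ℕ} (v : Vec (Fin m) m) (matching : IsMatching v) where

  partner : ℕ → ℕ
  partner = lookupℕ v

  partner-< : ∀ x → x < m → partner x < m
  partner-< = lookupℕ-< v

  partner-involutive : ∀ x → x < m → partner (partner x) ≡ x
  partner-involutive x x<m with fromℕ< x<m | toℕ-fromℕ< x<m
  ... | i | refl = trans (cong partner (lookupℕ-toℕ v i))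
                         (trans (lookupℕ-toℕ v (lookup v i)) (cong toℕ (proj₁ (matching i))))

  partner-≢ : ∀ x → x < m → partner x ≢ x
  partner-≢ x x<m with fromℕ< x<m | toℕ-fromℕ< x<m
  ... | i | refl = λ eq → proj₂ (matching i) (toℕ-injective (trans (sym (lookupℕ-toℕ v i)) eq))

  sumBelow-partner : (F : ℕ → ℕ) → ∑[ p < m ] F (partner p) ≡ sumBelow m F
  sumBelow-partner F = trans (sym (sum-upTo m _)) (trans (sym reindex) (sum-upTo m F))
    where
    reindex : sumWhen (λ _ → true) F (upTo m) ≡ sumWhen (λ _ → true) (F ∘ partner) (upTo m)
    reindex = sumWhen-bijection (upTo m) (upTo m) _ _ partner F (Unique.upTo⁺ m) (Unique.upTo⁺ m)
      (λ y∈ _ → ∈-upTo⁺ (partner-< _ (∈-upTo⁻ y∈)) , refl)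
      (λ { {y₁} {y₂} (y₁∈ , _) (y₂∈ , _) eq →
           trans (sym (partner-involutive y₁ (∈-upTo⁻ y₁∈)))
                 (trans (cong partner eq) (partner-involutive y₂ (∈-upTo⁻ y₂∈))) })
      (λ {x} x∈ _ → partner x , ∈-upTo⁺ (partner-< x (∈-upTo⁻ x∈)) , refl , partner-involutive x (∈-upTo⁻ x∈))

  opener-or-closer : ∀ p → p < m → indicator (p <ᵇ partner p) + indicator (partner p <ᵇ p) ≡ 1
  opener-or-closer p p<m with <-cmp p (partner p)
  ... | tri< p<q _ _ rewrite <ᵇ-true p<q | <ᵇ-false (<⇒≤ p<q) = refl
  ... | tri≈ _ p≡q _ = ⊥-elim (partner-≢ p p<m (sym p≡q))
  ... | tri> _ _ q<p rewrite <ᵇ-true q<p | <ᵇ-false (<⇒≤ q<p) = refl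

  -- Openers and closers are exchanged by the involution, so they are equinumerous.
  openerCount : ∀ h → m ≡ h + h → ∑[ p < m ] indicator (p <ᵇ partner p) ≡ h
  openerCount h m≡2h = +-double-injective _ _ (trans twice m≡2h)
    where
    open ≡-Reasoning
    S : ℕ
    S = ∑[ p < m ] indicator (p <ᵇ partner p)
    twice : S + S ≡ m
    twice = begin
      S + S
        ≡⟨ cong (S +_) (trans (sumBelow-cong m (λ p p<m → cong (λ z → indicator (z <ᵇ partner p))
                                                                (sym (partner-involutive p p<m))))
                              (sumBelow-partner (λ y → indicator (partner y <ᵇ y)))) ⟩
      S + ∑[ p < m ] indicator (partner p <ᵇ p)          ≡⟨ sym (sumBelow-distrib-+ m _ _) ⟩
      ∑[ p < m ] (indicator (p <ᵇ partner p) + indicator (partner p <ᵇ p)) ≡⟨ sumBelow-cong m opener-or-closer ⟩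
      ∑[ p < m ] 1                                       ≡⟨ sumBelow-const m 1 ⟩
      m * 1                                              ≡⟨ *-identityʳ m ⟩
      m ∎

-- The new arc is (a, c + 1): the hole punched at c in [M + 1] moves to c + 1 once a ≤ c is punched in.
module InsertArc (M c a : ℕ) where

  cPos : Fin (suc M)
  cPos = clamp M c

  aPos : Fin (suc (suc M))
  aPos = clamp (suc M) a

  hPos : Fin (suc (suc M))
  hPos = punchIn aPos cPos

  embed : Fin M → Fin (suc (suc M))
  embed j = punchIn aPos (punchIn cPos j)

  insertArc : Vec (Fin M) M → Vec (Fin (suc (suc M))) (suc (suc M))
  insertArc σ = insertAt (insertAt (Vec.map embed σ) cPos aPos) aPos hPos

  shift : ℕ → ℕ
  shift p = skip a (skip c p)

  module _ (σ : Vec (Fin M) M) where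

    insertArc-a : lookup (insertArc σ) aPos ≡ hPos
    insertArc-a = insertAt-lookup _ aPos hPos

    insertArc-h : lookup (insertArc σ) hPos ≡ aPos
    insertArc-h = trans (insertAt-punchIn _ aPos hPos cPos) (insertAt-lookup _ cPos aPos)

    insertArc-embed : ∀ j → lookup (insertArc σ) (embed j) ≡ embed (lookup σ j)
    insertArc-embed j =
      trans (insertAt-punchIn _ aPos hPos (punchIn cPos j)) (trans (insertAt-punchIn _ cPos aPos j) (lookup-map j embed σ))

  embed-injective : ∀ {j k} → embed j ≡ embed k → j ≡ k
  embed-injective {j} {k} eq = punchIn-injective cPos j k (punchIn-injective aPos _ _ eq)

  embed≢a : ∀ j → embed j ≢ aPos
  embed≢a j = punchInᵢ≢i aPos _

  embed≢h : ∀ j → embed j ≢ hPos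
  embed≢h j eq = punchInᵢ≢i cPos j (punchIn-injective aPos _ _ eq)

  a≢h : aPos ≢ hPos
  a≢h eq = punchInᵢ≢i aPos cPos (sym eq)

  position-view : ∀ (i : Fin (suc (suc M))) → (i ≡ aPos) ⊎ (i ≡ hPos) ⊎ (∃ λ j → i ≡ embed j)
  position-view i with punchIn-view aPos i
  ... | inj₁ i≡a = inj₁ i≡a
  ... | inj₂ (i′ , refl) with punchIn-view cPos i′
  ...   | inj₁ refl          = inj₂ (inj₁ refl)
  ...   | inj₂ (j , refl)    = inj₂ (inj₂ (j , refl))

  insertArc-IsMatching : (σ : Vec (Fin M) M) → IsMatching σ → IsMatching (insertArc σ)
  insertArc-IsMatching σ matching i with position-view i
  ... | inj₁ refl =
        trans (cong (lookup (insertArc σ)) (insertArc-a σ)) (insertArc-h σ)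
      , (λ eq → a≢h (sym (trans (sym (insertArc-a σ)) eq)))
  ... | inj₂ (inj₁ refl) =
        trans (cong (lookup (insertArc σ)) (insertArc-h σ)) (insertArc-a σ)
      , (λ eq → a≢h (trans (sym (insertArc-h σ)) eq))
  ... | inj₂ (inj₂ (j , refl)) =
        trans (cong (lookup (insertArc σ)) (insertArc-embed σ j))
              (trans (insertArc-embed σ (lookup σ j)) (cong embed (proj₁ (matching j))))
      , (λ eq → proj₂ (matching j) (embed-injective (trans (sym (insertArc-embed σ j)) eq)))

  insertArc-injective : ∀ σ τ → insertArc σ ≡ insertArc τ → σ ≡ τ
  insertArc-injective σ τ eq = Vec-ext σ τ (λ j → embed-injective
    (trans (sym (insertArc-embed σ j)) (trans (cong (λ v → lookup v (embed j)) eq) (insertArc-embed τ j))))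

  module Values (c≤M : c ≤ M) (a≤c : a ≤ c) where

    toℕ-aPos : toℕ aPos ≡ a
    toℕ-aPos = toℕ-clamp (suc M) a (≤-trans a≤c (≤-trans c≤M (n≤1+n M)))

    toℕ-hPos : toℕ hPos ≡ suc c
    toℕ-hPos = trans (toℕ-punchIn aPos cPos) (trans (cong₂ skip toℕ-aPos (toℕ-clamp M c c≤M)) (skip-above a≤c))

    toℕ-embed : ∀ j → toℕ (embed j) ≡ shift (toℕ j)
    toℕ-embed j = trans (toℕ-punchIn aPos _)
      (cong₂ skip toℕ-aPos (trans (toℕ-punchIn cPos j) (cong (λ z → skip z (toℕ j)) (toℕ-clamp M c c≤M))))

    module _ (σ : Vec (Fin M) M) where

      lookupℕ-insertArc-a : lookupℕ (insertArc σ) a ≡ suc c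
      lookupℕ-insertArc-a = trans (cong (lookupℕ (insertArc σ)) (sym toℕ-aPos))
        (trans (lookupℕ-toℕ (insertArc σ) aPos) (trans (cong toℕ (insertArc-a σ)) toℕ-hPos))

      lookupℕ-insertArc-h : lookupℕ (insertArc σ) (suc c) ≡ a
      lookupℕ-insertArc-h = trans (cong (lookupℕ (insertArc σ)) (sym toℕ-hPos))
        (trans (lookupℕ-toℕ (insertArc σ) hPos) (trans (cong toℕ (insertArc-h σ)) toℕ-aPos))

      lookupℕ-insertArc-shift : ∀ p → p < M → lookupℕ (insertArc σ) (shift p) ≡ shift (lookupℕ σ p)
      lookupℕ-insertArc-shift p p<M = begin
        lookupℕ (insertArc σ) (shift p)        ≡⟨ cong (lookupℕ (insertArc σ)) (sym (trans (toℕ-embed j) (cong shift toℕ-j)))  ⟩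
        lookupℕ (insertArc σ) (toℕ (embed j))  ≡⟨ lookupℕ-toℕ (insertArc σ) (embed j) ⟩
        toℕ (lookup (insertArc σ) (embed j))   ≡⟨ cong toℕ (insertArc-embed σ j) ⟩
        toℕ (embed (lookup σ j))               ≡⟨ toℕ-embed (lookup σ j) ⟩
        shift (toℕ (lookup σ j))               ≡⟨ cong shift (trans (sym (lookupℕ-toℕ σ j)) (cong (lookupℕ σ) toℕ-j)) ⟩
        shift (lookupℕ σ p) ∎
        where
        open ≡-Reasoning
        j : Fin M
        j = fromℕ< p<M
        toℕ-j : toℕ j ≡ p
        toℕ-j = toℕ-fromℕ< p<M

sumBelow-skip : ∀ K c → c ≤ K → (H : ℕ → ℕ) → sumBelow (suc K) H ≡ H c + ∑[ p < K ] H (skip c p)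
sumBelow-skip K       zero    _         H = refl
sumBelow-skip (suc K) (suc c) (s≤s c≤K) H = begin
  H 0 + sumBelow (suc K) (H ∘ suc)      ≡⟨ cong (H 0 +_) (sumBelow-skip K c c≤K (H ∘ suc)) ⟩
  H 0 + (H (suc c) + R)                 ≡⟨ solve 3 (λ x y r → x :+ (y :+ r) := y :+ (x :+ r)) refl (H 0) (H (suc c)) R ⟩
  H (suc c) + (H 0 + R) ∎
  where
  open ≡-Reasoning
  R : ℕ
  R = ∑[ p < K ] H (suc (skip c p))

sumBelow-insertArc : ∀ M c a → c ≤ M → a ≤ c → (H : ℕ → ℕ) →
  sumBelow (suc (suc M)) H ≡ H a + (H (suc c) + ∑[ p < M ] H (skip a (skip c p)))
sumBelow-insertArc M c a c≤M a≤c H =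
  trans (sumBelow-skip (suc M) a (≤-trans a≤c (≤-trans c≤M (n≤1+n M))) H)
        (cong (H a +_) (trans (sumBelow-skip M c c≤M (H ∘ skip a))
                              (cong (λ z → H z + ∑[ p < M ] H (skip a (skip c p))) (skip-above a≤c))))

sumBelow²-insertArc : ∀ M c a → c ≤ M → a ≤ c → (F : ℕ → ℕ → ℕ) → let h = suc c; e = skip a ∘ skip c in
  ∑[ x < suc (suc M) ] ∑[ y < suc (suc M) ] F x y
    ≡ (F a a + F a h + F h a + F h h)
      + (∑[ p < M ] (F a (e p) + F (e p) a + F (e p) h + F h (e p)) + ∑[ p < M ] ∑[ q < M ] F (e p) (e q))
sumBelow²-insertArc M c a c≤M a≤c F = begin
  ∑[ x < suc (suc M) ] ∑[ y < suc (suc M) ] F x y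
    ≡⟨ sumBelow-cong (suc (suc M)) (λ x _ → sumBelow-insertArc M c a c≤M a≤c (F x)) ⟩
  sumBelow (suc (suc M)) row
    ≡⟨ sumBelow-insertArc M c a c≤M a≤c row ⟩
  row a + (row h + ∑[ p < M ] row (e p))
    ≡⟨ cong (λ z → row a + (row h + z)) (trans (sumBelow-distrib-+ M (λ p → F (e p) a) (λ p → F (e p) h + rowOld (e p)))
                                            (cong (Ea +_) (sumBelow-distrib-+ M (λ p → F (e p) h) (rowOld ∘ e)))) ⟩
  row a + (row h + (Ea + (Eh + ∑[ p < M ] rowOld (e p))))
    ≡⟨ solve 9 (λ aa ah ha hh sa sh x₁ x₂ x₃ →
         (aa :+ (ah :+ sa)) :+ ((ha :+ (hh :+ sh)) :+ (x₁ :+ (x₂ :+ x₃)))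
           := (aa :+ ah :+ ha :+ hh) :+ ((((sa :+ x₁) :+ x₂) :+ sh) :+ x₃))
         refl (F a a) (F a h) (F h a) (F h h) (rowOld a) (rowOld h) Ea Eh (∑[ p < M ] rowOld (e p)) ⟩
  (F a a + F a h + F h a + F h h) + (((rowOld a + Ea) + Eh) + rowOld h + ∑[ p < M ] rowOld (e p))
    ≡⟨ cong (λ z → (F a a + F a h + F h a + F h h) + (z + ∑[ p < M ] rowOld (e p))) (sym mixed) ⟩
  (F a a + F a h + F h a + F h h) + (∑[ p < M ] (F a (e p) + F (e p) a + F (e p) h + F h (e p)) + ∑[ p < M ] rowOld (e p)) ∎
  where
  open ≡-Reasoning
  h : ℕ
  h = suc c
  e : ℕ → ℕ
  e = skip a ∘ skip c
  rowOld : ℕ → ℕ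
  rowOld x = ∑[ q < M ] F x (e q)
  row : ℕ → ℕ
  row x = F x a + (F x h + rowOld x)
  Ea Eh : ℕ
  Ea = ∑[ p < M ] F (e p) a
  Eh = ∑[ p < M ] F (e p) h
  mixed : ∑[ p < M ] (F a (e p) + F (e p) a + F (e p) h + F h (e p)) ≡ ((rowOld a + Ea) + Eh) + rowOld h
  mixed = trans (sumBelow-distrib-+ M (λ p → F a (e p) + F (e p) a + F (e p) h) (λ p → F h (e p)))
     (cong (_+ rowOld h) (trans (sumBelow-distrib-+ M (λ p → F a (e p) + F (e p) a) (λ p → F (e p) h))
       (cong (_+ Eh) (sumBelow-distrib-+ M (λ p → F a (e p)) (λ p → F (e p) a)))))

-- How the intertwining number grows when an arc is inserted

<ᵇ-shift : ∀ a c p → a ≤ c → (a <ᵇ skip a (skip c p)) ≡ not (p <ᵇ a)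
<ᵇ-shift a c p a≤c with <-cmp p a
... | tri< p<a _ _
    rewrite skip-below (<-≤-trans p<a a≤c) | skip-below p<a | <ᵇ-true p<a | <ᵇ-false (<⇒≤ p<a) = refl
... | tri≈ _ refl _
    rewrite skip-above (skip-≥ c p) | <ᵇ-true (s≤s (skip-≥ c p)) | <ᵇ-false (≤-refl {p}) = refl
... | tri> _ _ a<p
    rewrite skip-above (≤-trans (<⇒≤ a<p) (skip-≥ c p))
          | <ᵇ-true (s≤s (≤-trans (<⇒≤ a<p) (skip-≥ c p))) | <ᵇ-false (<⇒≤ a<p) = refl

module ArcInsertion (M m c a : ℕ) (M≡2m : M ≡ m + m) (c≤m : c ≤ m) (a≤c : a ≤ c)
                    (σ : Vec (Fin M) M) (matching : IsMatching σ) (openers : openersBelow c σ ≡ true) where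

  c≤M : c ≤ M
  c≤M = subst (c ≤_) (sym M≡2m) (≤-trans c≤m (m≤m+n m m))

  open InsertArc M c a
  open Values c≤M a≤c
  open Involution σ matching

  crossingsIn : ℕ → ℕ → ℕ
  crossingsIn x y = crossingsBetween x (lookupℕ (insertArc σ) x) y (lookupℕ (insertArc σ) y)

  opener : ∀ p → p < c → p < partner p
  opener p p<c = <ᵇ-true⁻¹ (allBelow⁻¹ c _ openers p p<c)

  partner-≥ : ∀ p → p < c → p < M → c ≤ partner p
  partner-≥ p p<c p<M with <-cmp (partner p) c
  ... | tri< q<c _ _ = ⊥-elim (<-asym (opener p p<c) (subst (partner p <_) (partner-involutive p p<M) (opener (partner p) q<c)))
  ... | tri≈ _ q≡c _ = ≤-reflexive (sym q≡c)
  ... | tri> _ _ c<q = <⇒≤ c<q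

  newArcCrossings : ℕ → ℕ
  newArcCrossings p = if p <ᵇ c then (if not (p <ᵇ a) then 3 else 2) else indicator (p <ᵇ partner p)

  crossingsWithArc-shift : ∀ p → p < M →
    crossingsIn a (shift p) + crossingsIn (shift p) a + crossingsIn (shift p) (suc c) + crossingsIn (suc c) (shift p)
      ≡ newArcCrossings p
  crossingsWithArc-shift p p<M
    rewrite lookupℕ-insertArc-a σ | lookupℕ-insertArc-h σ | lookupℕ-insertArc-shift σ p p<M = begin
    crossingsWithArc a (suc c) (shift p) (shift (partner p))
      ≡⟨ crossingsWithArc-value a (suc c) (shift p) (shift (partner p))
           (s≤s a≤c) (skip-≢ a (skip c p)) shift≢h closesLater ⟩
    (if shift p <ᵇ suc c then (if a <ᵇ shift p then 3 else 2) else indicator (shift p <ᵇ shift (partner p)))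
      ≡⟨ cong₂ (λ b b′ → if b then (if a <ᵇ shift p then 3 else 2) else indicator b′) shift<h shift-<ᵇ ⟩
    (if p <ᵇ c then (if a <ᵇ shift p then 3 else 2) else indicator (p <ᵇ partner p))
      ≡⟨ cong (λ b → if p <ᵇ c then (if b then 3 else 2) else indicator (p <ᵇ partner p)) (<ᵇ-shift a c p a≤c) ⟩
    newArcCrossings p ∎
    where
    open ≡-Reasoning
    shift-<ᵇ : (shift p <ᵇ shift (partner p)) ≡ (p <ᵇ partner p)
    shift-<ᵇ = trans (skip-<ᵇ a (skip c p) (skip c (partner p))) (skip-<ᵇ c p (partner p))
    shift<h : (shift p <ᵇ suc c) ≡ (p <ᵇ c)
    shift<h = trans (cong (shift p <ᵇ_) (sym (skip-above a≤c))) (trans (skip-<ᵇ a (skip c p) c) (skip-<ᵇ-self c p))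
    shift≢h : shift p ≢ suc c
    shift≢h eq = skip-≢ c p (skip-injective a (trans eq (sym (skip-above a≤c))))
    closesLater : shift p < suc c → suc c < shift (partner p)
    closesLater lt =
      subst (suc c <_) (sym (trans (cong (skip a) (skip-above c≤q)) (skip-above (≤-trans a≤c (≤-trans c≤q (n≤1+n _))))))
            (s≤s (s≤s c≤q))
      where
      c≤q : c ≤ partner p
      c≤q = partner-≥ p (<ᵇ-true⁻¹ (trans (sym shift<h) (<ᵇ-true lt))) p<M

  laterOpeners : ℕ
  laterOpeners = ∑[ i < M ∸ c ] indicator (c + i <ᵇ partner (c + i))

  M≡c+r : M ≡ c + (M ∸ c)
  M≡c+r = sym (m+[n∸m]≡n c≤M)

  sum-newArcCrossings : sumBelow M newArcCrossings ≡ (a * 2 + (c ∸ a) * 3) + laterOpeners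
  sum-newArcCrossings = begin
    sumBelow M newArcCrossings                         ≡⟨ cong (λ k → sumBelow k newArcCrossings) M≡c+r ⟩
    sumBelow (c + (M ∸ c)) newArcCrossings             ≡⟨ sumBelow-split c (M ∸ c) newArcCrossings ⟩
    sumBelow c newArcCrossings + ∑[ i < M ∸ c ] newArcCrossings (c + i)
      ≡⟨ cong₂ _+_ early (sumBelow-cong (M ∸ c) (λ i _ →
           cong (λ b → if b then weight (c + i) else indicator (c + i <ᵇ partner (c + i)))
                                                              (<ᵇ-false (m≤m+n c i)))) ⟩
    (a * 2 + (c ∸ a) * 3) + laterOpeners ∎
    where
    open ≡-Reasoning
    weight : ℕ → ℕ
    weight p = if not (p <ᵇ a) then 3 else 2
    early : sumBelow c newArcCrossings ≡ a * 2 + (c ∸ a) * 3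
    early = begin
      sumBelow c newArcCrossings
        ≡⟨ sumBelow-cong c (λ p p<c → cong (λ b → if b then weight p else indicator (p <ᵇ partner p)) (<ᵇ-true p<c)) ⟩
      sumBelow c weight                     ≡⟨ cong (λ k → sumBelow k weight) (sym (m+[n∸m]≡n a≤c)) ⟩
      sumBelow (a + (c ∸ a)) weight         ≡⟨ sumBelow-split a (c ∸ a) weight ⟩
      sumBelow a weight + ∑[ i < c ∸ a ] weight (a + i)
        ≡⟨ cong₂ _+_ (sumBelow-cong a (λ p p<a → cong (λ b → if not b then 3 else 2) (<ᵇ-true p<a)))
                     (sumBelow-cong (c ∸ a) (λ i _ → cong (λ b → if not b then 3 else 2) (<ᵇ-false (m≤m+n a i)))) ⟩
      ∑[ i < a ] 2 + ∑[ i < c ∸ a ] 3       ≡⟨ cong₂ _+_ (sumBelow-const a 2) (sumBelow-const (c ∸ a) 3) ⟩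
      a * 2 + (c ∸ a) * 3 ∎

  c+laterOpeners≡m : c + laterOpeners ≡ m
  c+laterOpeners≡m = begin
    c + laterOpeners
      ≡⟨ cong (_+ laterOpeners) (sym (trans (sumBelow-cong c (λ p p<c → cong indicator (<ᵇ-true (opener p p<c))))
                                             (trans (sumBelow-const c 1) (*-identityʳ c)))) ⟩
    ∑[ p < c ] indicator (p <ᵇ partner p) + laterOpeners ≡⟨ sym (sumBelow-split c (M ∸ c) _) ⟩
    ∑[ p < c + (M ∸ c) ] indicator (p <ᵇ partner p)
      ≡⟨ cong (λ k → ∑[ p < k ] indicator (p <ᵇ partner p)) (sym M≡c+r) ⟩
    ∑[ p < M ] indicator (p <ᵇ partner p)                ≡⟨ openerCount m M≡2m ⟩
    m ∎
    where open ≡-Reasoning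

  oldCrossings : ∑[ p < M ] ∑[ q < M ] crossingsIn (shift p) (shift q)
               ≡ ∑[ p < M ] ∑[ q < M ] crossingsBetween p (partner p) q (partner q)
  oldCrossings = sumBelow-cong M (λ p p<M → sumBelow-cong M (λ q q<M →
    trans (cong₂ (λ X Y → crossingsBetween (shift p) X (shift q) Y)
                 (lookupℕ-insertArc-shift σ p p<M) (lookupℕ-insertArc-shift σ q q<M))
          (OrderEmbedding.crossingsBetween-embed shift (λ u v → trans (skip-<ᵇ a (skip c u) (skip c v)) (skip-<ᵇ c u v))
             p (partner p) q (partner q))))

  newArcSelfCrossings : crossingsIn a a + crossingsIn a (suc c) + crossingsIn (suc c) a + crossingsIn (suc c) (suc c) ≡ 0
  newArcSelfCrossings rewrite lookupℕ-insertArc-a σ | lookupℕ-insertArc-h σ = crossingsWithArc-self a (suc c) (s≤s a≤c)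

  intertwining-insertArc : intertwining (insertArc σ) ≡ intertwining σ + ((c ∸ a) + (c + m))
  intertwining-insertArc = begin
    intertwining (insertArc σ)
      ≡⟨ intertwining≡∑∑crossingsBetween (insertArc σ) ⟩
    ∑[ x < suc (suc M) ] ∑[ y < suc (suc M) ] crossingsIn x y
      ≡⟨ sumBelow²-insertArc M c a c≤M a≤c crossingsIn ⟩
    _ ≡⟨ cong₂ _+_ newArcSelfCrossings
                   (cong₂ _+_ (trans (sumBelow-cong M crossingsWithArc-shift) sum-newArcCrossings) oldCrossings) ⟩
    0 + (((a * 2 + d * 3) + laterOpeners) + ∑[ p < M ] ∑[ q < M ] crossingsBetween p (partner p) q (partner q))
      ≡⟨ cong (λ z → 0 + (((a * 2 + d * 3) + laterOpeners) + z)) (sym (intertwining≡∑∑crossingsBetween σ)) ⟩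
    0 + (((a * 2 + d * 3) + laterOpeners) + intertwining σ)
      ≡⟨ solve 4 (λ a d r i → con 0 :+ (((a :* con 2 :+ d :* con 3) :+ r) :+ i)
                         := i :+ (d :+ ((a :+ d) :+ ((a :+ d) :+ r))))
           refl a d laterOpeners (intertwining σ) ⟩
    intertwining σ + (d + ((a + d) + ((a + d) + laterOpeners)))
      ≡⟨ cong (λ z → intertwining σ + (d + (z + (z + laterOpeners)))) (m+[n∸m]≡n a≤c) ⟩
    intertwining σ + (d + (c + (c + laterOpeners)))
      ≡⟨ cong (λ z → intertwining σ + (d + (c + z))) c+laterOpeners≡m ⟩
    intertwining σ + (d + (c + m)) ∎
    where
    open ≡-Reasoning
    d : ℕ
    d = c ∸ a

module RemoveArc (M c : ℕ) (c≤M : c ≤ M) (π : Vec (Fin (suc (suc M))) (suc (suc M))) (matching : IsMatching π)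
                 (a≤c : lookupℕ π (suc c) ≤ c) where

  a : ℕ
  a = lookupℕ π (suc c)

  open InsertArc M c a
  open Values c≤M a≤c

  π-h : lookup π hPos ≡ aPos
  π-h = toℕ-injective (trans (sym (lookupℕ-toℕ π hPos)) (trans (cong (lookupℕ π) toℕ-hPos) (sym toℕ-aPos)))

  π-a : lookup π aPos ≡ hPos
  π-a = trans (cong (lookup π) (sym π-h)) (proj₁ (matching hPos))

  a≢π-embed : ∀ j → aPos ≢ lookup π (embed j)
  a≢π-embed j eq = embed≢h j (trans (sym (proj₁ (matching (embed j)))) (trans (cong (lookup π) (sym eq)) π-a))

  c≢π-embed : ∀ j → cPos ≢ punchOut (a≢π-embed j)
  c≢π-embed j eq = embed≢a j (trans (sym (proj₁ (matching (embed j)))) (trans (cong (lookup π) (sym h≡π-embed)) π-h))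
    where
    h≡π-embed : hPos ≡ lookup π (embed j)
    h≡π-embed = trans (cong (punchIn aPos) eq) (punchIn-punchOut (a≢π-embed j))

  removeArc : Vec (Fin M) M
  removeArc = tabulate (λ j → punchOut (c≢π-embed j))

  embed-removeArc : ∀ j → embed (lookup removeArc j) ≡ lookup π (embed j)
  embed-removeArc j =
    trans (cong embed (lookup∘tabulate (λ j → punchOut (c≢π-embed j)) j))
          (trans (cong (punchIn aPos) (punchIn-punchOut (c≢π-embed j))) (punchIn-punchOut (a≢π-embed j)))

  insertArc-removeArc : insertArc removeArc ≡ π
  insertArc-removeArc = Vec-ext (insertArc removeArc) π agree
    where
    agree : ∀ i → lookup (insertArc removeArc) i ≡ lookup π i
    agree i with position-view i
    ... | inj₁ refl              = trans (insertArc-a removeArc) (sym π-a)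
    ... | inj₂ (inj₁ refl)       = trans (insertArc-h removeArc) (sym π-h)
    ... | inj₂ (inj₂ (j , refl)) = trans (insertArc-embed removeArc j) (embed-removeArc j)

  removeArc-IsMatching : IsMatching removeArc
  removeArc-IsMatching j =
      embed-injective (trans (embed-removeArc (lookup removeArc j))
                             (trans (cong (lookup π) (embed-removeArc j)) (proj₁ (matching (embed j)))))
    , (λ eq → proj₂ (matching (embed j)) (trans (sym (embed-removeArc j)) (cong embed eq)))

  removeArc-openersBelow : openersBelow (suc c) π ≡ true → openersBelow c removeArc ≡ true
  removeArc-openersBelow openers = allBelow-intro c _ opensAt
    where
    opensAt : ∀ p → p < c → (p <ᵇ lookupℕ removeArc p) ≡ true
    opensAt p p<c = begin
      p <ᵇ lookupℕ removeArc p
        ≡⟨ sym (trans (skip-<ᵇ a (skip c p) (skip c (lookupℕ removeArc p))) (skip-<ᵇ c p (lookupℕ removeArc p))) ⟩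
      shift p <ᵇ shift (lookupℕ removeArc p)
        ≡⟨ cong (shift p <ᵇ_) (sym (trans (cong (λ v → lookupℕ v (shift p)) (sym insertArc-removeArc))
                                           (lookupℕ-insertArc-shift removeArc p (<-≤-trans p<c c≤M)))) ⟩
      shift p <ᵇ lookupℕ π (shift p)
        ≡⟨ allBelow⁻¹ (suc c) _ openers (shift p)
             (subst (_< suc c) (cong (skip a) (sym (skip-below p<c))) (skip-< a p<c)) ⟩
      true ∎
      where open ≡-Reasoning

-- Generating functions of matchings beginning with h openers

openerPrefixGF : (N h q : ℕ) → ℕ
openerPrefixGF N h q = sumWhen (λ v → isPM v ∧ openersBelow h v) (λ v → q ^ intertwining v) (allVecs N N)

pmGenFun≡openerPrefixGF-0 : ∀ N q → pmGenFun N q ≡ openerPrefixGF N 0 q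
pmGenFun≡openerPrefixGF-0 N q =
  sum-map-cong (allVecs N N) (λ v → cong (λ b → if b then q ^ intertwining v else 0) (sym (∧-identityʳ (isPM v))))

firstCloserAt : {N : ℕ} → ℕ → Vec (Fin N) N → Bool
firstCloserAt h v = isPM v ∧ (openersBelow h v ∧ (lookupℕ v h <ᵇ h))

openerPrefixGF-suc : ∀ N h q → h < N →
  openerPrefixGF N h q ≡ openerPrefixGF N (suc h) q + sumWhen (firstCloserAt h) (λ v → q ^ intertwining v) (allVecs N N)
openerPrefixGF-suc N h q h<N =
  trans (sum-map-cong (allVecs N N) openerOrCloser) (sum-map-+ _ _ (allVecs N N))
  where
  openerOrCloser : ∀ v → (if isPM v ∧ openersBelow h v then q ^ intertwining v else 0)
                       ≡ (if isPM v ∧ openersBelow (suc h) v then q ^ intertwining v else 0)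
                         + (if firstCloserAt h v then q ^ intertwining v else 0)
  openerOrCloser v with isPM v in isPMv | openersBelow h v
  ... | false | _     = refl
  ... | true  | false = refl
  ... | true  | true with <-cmp h (lookupℕ v h)
  ...   | tri< h<q _ _ rewrite <ᵇ-true h<q | <ᵇ-false (<⇒≤ h<q) = sym (+-identityʳ _)
  ...   | tri≈ _ h≡q _ = ⊥-elim (Involution.partner-≢ v (isPM⇒IsMatching v isPMv) h h<N (sym h≡q))
  ...   | tri> _ _ q<h rewrite <ᵇ-true q<h | <ᵇ-false (<⇒≤ q<h) = refl

-- A matching on [2m] has only m openers.
openerPrefixGF-vanishes : ∀ m h q → m < h → openerPrefixGF (m + m) h q ≡ 0
openerPrefixGF-vanishes m h q m<h = sum-map-zero _ (allVecs (m + m) (m + m)) noMatching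
  where
  noMatching : ∀ v → (if isPM v ∧ openersBelow h v then q ^ intertwining v else 0) ≡ 0
  noMatching v with isPM v in isPMv | openersBelow h v in openers
  ... | false | _     = refl
  ... | true  | false = refl
  ... | true  | true with ≤-<-connex h (m + m)
  ...   | inj₁ h≤2m = ⊥-elim (<⇒≱ m<h (subst (h ≤_) (openerCount m refl) h≤openers))
    where
    open Involution v (isPM⇒IsMatching v isPMv)
    allOpen : ∑[ p < h ] indicator (p <ᵇ partner p) ≡ h
    allOpen = trans (sumBelow-cong h (λ p p<h → cong indicator (allBelow⁻¹ h _ openers p p<h)))
                    (trans (sumBelow-const h 1) (*-identityʳ h))
    h≤openers : h ≤ ∑[ p < m + m ] indicator (p <ᵇ partner p)
    h≤openers = subst (λ k → h ≤ ∑[ p < k ] indicator (p <ᵇ partner p)) (m+[n∸m]≡n h≤2m)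
      (subst (_≤ ∑[ p < h + (m + m ∸ h) ] indicator (p <ᵇ partner p)) allOpen
        (subst (∑[ p < h ] indicator (p <ᵇ partner p) ≤_) (sym (sumBelow-split h (m + m ∸ h) _)) (m≤m+n _ _)))
  ...   | inj₂ 2m<h = ⊥-elim (0≮2m (allBelow⁻¹ h _ openers (m + m) 2m<h))
    where
    0≮2m : (m + m <ᵇ lookupℕ v (m + m)) ≢ true
    0≮2m rewrite lookupℕ-≥ v (m + m) ≤-refl = λ ()

openerPrefixGF-0≡1 : ∀ N q → 0 < N → openerPrefixGF N 0 q ≡ openerPrefixGF N 1 q
openerPrefixGF-0≡1 N q 0<N = sum-map-cong (allVecs N N) firstOpens
  where
  firstOpens : ∀ v → (if isPM v ∧ true then q ^ intertwining v else 0)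
                   ≡ (if isPM v ∧ (true ∧ (0 <ᵇ lookupℕ v 0)) then q ^ intertwining v else 0)
  firstOpens v with isPM v in isPMv
  ... | false = refl
  ... | true with lookupℕ v 0 | Involution.partner-≢ v (isPM⇒IsMatching v isPMv) 0 0<N
  ...   | zero  | 0≢0 = ⊥-elim (0≢0 refl)
  ...   | suc _ | _   = refl

module FirstCloser (M m c q : ℕ) (M≡2m : M ≡ m + m) (c≤m : c ≤ m) where

  N : ℕ
  N = suc (suc M)

  c≤M : c ≤ M
  c≤M = subst (c ≤_) (sym M≡2m) (≤-trans c≤m (m≤m+n m m))

  candidates : List (ℕ × Vec (Fin M) M)
  candidates = concatMap (λ a → map (a ,_) (allVecs M M)) (upTo (suc c))

  Unique-candidates : Unique candidates
  Unique-candidates =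
    Unique-concatMap _ (upTo (suc c)) (Unique.upTo⁺ (suc c)) (λ a → Unique.map⁺ (cong proj₂) (Unique-allVecs M M)) firsts≡
    where
    firsts≡ : ∀ {a b y} → y ∈ map (a ,_) (allVecs M M) → y ∈ map (b ,_) (allVecs M M) → a ≡ b
    firsts≡ y∈a y∈b with ∈-map⁻ _ y∈a | ∈-map⁻ _ y∈b
    ... | _ , _ , refl | _ , _ , eq = cong proj₁ eq

  ∈-candidates⁻ : ∀ {a σ} → (a , σ) ∈ candidates → a < suc c
  ∈-candidates⁻ y∈ with find (∈-concatMap⁻ _ y∈)
  ... | a , a∈ , y∈a with ∈-map⁻ (a ,_) y∈a
  ...   | _ , _ , refl = ∈-upTo⁻ a∈

  ∈-candidates⁺ : ∀ {a} σ → a < suc c → (a , σ) ∈ candidates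
  ∈-candidates⁺ {a} σ a<1+c = ∈-concatMap⁺ _ (lose (∈-upTo⁺ a<1+c) (∈-map⁺ (a ,_) (∈-allVecs M M σ)))

  admissible : ℕ × Vec (Fin M) M → Bool
  admissible (a , σ) = isPM σ ∧ openersBelow c σ

  insert : ℕ × Vec (Fin M) M → Vec (Fin N) N
  insert (a , σ) = InsertArc.insertArc M c a σ

  insert-firstCloserAt : ∀ {y} → y ∈ candidates → admissible y ≡ true →
                         insert y ∈ allVecs N N × firstCloserAt (suc c) (insert y) ≡ true
  insert-firstCloserAt {a , σ} y∈ adm =
      ∈-allVecs N N _
    , cong₂ _∧_ (IsMatching⇒isPM (insertArc σ) (insertArc-IsMatching σ matching))
                (cong₂ _∧_ openers′ (trans (cong (_<ᵇ suc c) (lookupℕ-insertArc-h σ)) (<ᵇ-true a<1+c)))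
    where
    a<1+c : a < suc c
    a<1+c = ∈-candidates⁻ y∈
    a≤c : a ≤ c
    a≤c = s≤s⁻¹ a<1+c
    open InsertArc M c a
    open Values c≤M a≤c
    matching : IsMatching σ
    matching = isPM⇒IsMatching σ (∧-conicalˡ (isPM σ) _ adm)
    openers : openersBelow c σ ≡ true
    openers = ∧-conicalʳ (isPM σ) _ adm
    openers′ : openersBelow (suc c) (insertArc σ) ≡ true
    openers′ = allBelow-intro (suc c) _ opensAt
      where
      opensAt : ∀ x → x < suc c → (x <ᵇ lookupℕ (insertArc σ) x) ≡ true
      opensAt x x<1+c with skip-view a x c a≤c x<1+c
      ... | inj₁ refl = trans (cong (a <ᵇ_) (lookupℕ-insertArc-a σ)) (<ᵇ-true a<1+c)
      ... | inj₂ (y , y<c , refl) = begin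
        skip a y <ᵇ lookupℕ (insertArc σ) (skip a y)
          ≡⟨ cong (λ z → skip a z <ᵇ lookupℕ (insertArc σ) (skip a z)) (sym (skip-below y<c)) ⟩
        shift y <ᵇ lookupℕ (insertArc σ) (shift y)
          ≡⟨ cong (shift y <ᵇ_) (lookupℕ-insertArc-shift σ y (<-≤-trans y<c c≤M)) ⟩
        shift y <ᵇ shift (lookupℕ σ y)
          ≡⟨ trans (skip-<ᵇ a (skip c y) (skip c (lookupℕ σ y))) (skip-<ᵇ c y (lookupℕ σ y)) ⟩
        y <ᵇ lookupℕ σ y
          ≡⟨ allBelow⁻¹ c _ openers y y<c ⟩
        true ∎
        where open ≡-Reasoning

  -- The partner a of c + 1 is recovered from the inserted matching.
  insert-injective : ∀ {y₁ y₂} → y₁ ∈ candidates × admissible y₁ ≡ true →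
                     y₂ ∈ candidates × admissible y₂ ≡ true →
                     insert y₁ ≡ insert y₂ → y₁ ≡ y₂
  insert-injective {a₁ , σ₁} {a₂ , σ₂} (y₁∈ , _) (y₂∈ , _) eq
    with trans (sym (InsertArc.Values.lookupℕ-insertArc-h M c a₁ c≤M (s≤s⁻¹ (∈-candidates⁻ y₁∈)) σ₁))
               (trans (cong (λ v → lookupℕ v (suc c)) eq)
                      (InsertArc.Values.lookupℕ-insertArc-h M c a₂ c≤M (s≤s⁻¹ (∈-candidates⁻ y₂∈)) σ₂))
  ... | refl = cong (a₁ ,_) (InsertArc.insertArc-injective M c a₁ σ₁ σ₂ eq)

  insert-surjective : ∀ {π} → π ∈ allVecs N N → firstCloserAt (suc c) π ≡ true →
                      ∃ λ y → y ∈ candidates × admissible y ≡ true × insert y ≡ π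
  insert-surjective {π} _ firstCloser =
      (a , removeArc) , ∈-candidates⁺ removeArc a<1+c
    , cong₂ _∧_ (IsMatching⇒isPM removeArc removeArc-IsMatching) (removeArc-openersBelow openers)
    , insertArc-removeArc
    where
    isPMπ : isPM π ≡ true
    isPMπ = ∧-conicalˡ (isPM π) _ firstCloser
    openers : openersBelow (suc c) π ≡ true
    openers = ∧-conicalˡ (openersBelow (suc c) π) _ (∧-conicalʳ (isPM π) _ firstCloser)
    a<1+c : lookupℕ π (suc c) < suc c
    a<1+c = <ᵇ-true⁻¹ (∧-conicalʳ (openersBelow (suc c) π) _ (∧-conicalʳ (isPM π) _ firstCloser))
    open RemoveArc M c c≤M π (isPM⇒IsMatching π isPMπ) (s≤s⁻¹ a<1+c)

  firstCloserGF : sumWhen (firstCloserAt (suc c)) (λ v → q ^ intertwining v) (allVecs N N)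
                ≡ q ^ (c + m) * qInt (suc c) q * openerPrefixGF M c q
  firstCloserGF = begin
    sumWhen (firstCloserAt (suc c)) (λ v → q ^ intertwining v) (allVecs N N)
      ≡⟨ sumWhen-bijection (allVecs N N) candidates _ admissible insert _ (Unique-allVecs N N) Unique-candidates
           insert-firstCloserAt insert-injective insert-surjective ⟩
    sum (map weight candidates)
      ≡⟨ sum-concatMap weight (λ a → map (a ,_) (allVecs M M)) (upTo (suc c)) ⟩
    sum (map (λ a → sum (map weight (map (a ,_) (allVecs M M)))) (upTo (suc c)))
      ≡⟨ sum-upTo (suc c) _ ⟩
    ∑[ a < suc c ] sum (map weight (map (a ,_) (allVecs M M)))
      ≡⟨ sumBelow-cong (suc c) partnerAt ⟩
    ∑[ a < suc c ] (K * q ^ (c ∸ a))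
      ≡⟨ sumBelow-*ˡ (suc c) K (λ a → q ^ (c ∸ a)) ⟩
    K * ∑[ a < suc c ] (q ^ (c ∸ a))
      ≡⟨ cong (K *_) (trans (sumBelow-reverse c (q ^_)) (sym (sum-upTo (suc c) (q ^_)))) ⟩
    K * qInt (suc c) q
      ≡⟨ solve 3 (λ x y z → (x :* y) :* z := x :* z :* y) refl (q ^ (c + m)) (openerPrefixGF M c q) (qInt (suc c) q) ⟩
    q ^ (c + m) * qInt (suc c) q * openerPrefixGF M c q ∎
    where
    open ≡-Reasoning
    weight : ℕ × Vec (Fin M) M → ℕ
    weight y = if admissible y then q ^ intertwining (insert y) else 0
    K : ℕ
    K = q ^ (c + m) * openerPrefixGF M c q
    partnerAt : ∀ a → a < suc c → sum (map weight (map (a ,_) (allVecs M M))) ≡ K * q ^ (c ∸ a)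
    partnerAt a a<1+c = begin
      sum (map weight (map (a ,_) (allVecs M M)))   ≡⟨ cong sum (sym (map-∘ (allVecs M M))) ⟩
      sum (map (λ σ → weight (a , σ)) (allVecs M M)) ≡⟨ sum-map-cong (allVecs M M) shifted ⟩
      sum (map (λ σ → L * (if admissible (a , σ) then q ^ intertwining σ else 0)) (allVecs M M))
        ≡⟨ sum-map-*ˡ L _ (allVecs M M) ⟩
      L * openerPrefixGF M c q                       ≡⟨ cong (_* openerPrefixGF M c q) (^-distribˡ-+-* q (c ∸ a) (c + m)) ⟩
      q ^ (c ∸ a) * q ^ (c + m) * openerPrefixGF M c q
        ≡⟨ solve 3 (λ x y z → x :* y :* z := (y :* z) :* x) refl (q ^ (c ∸ a)) (q ^ (c + m)) (openerPrefixGF M c q) ⟩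
      K * q ^ (c ∸ a) ∎
      where
      L : ℕ
      L = q ^ ((c ∸ a) + (c + m))
      shifted : ∀ σ → weight (a , σ) ≡ L * (if admissible (a , σ) then q ^ intertwining σ else 0)
      shifted σ with isPM σ in isPMσ | openersBelow c σ in openers
      ... | false | _     = sym (*-zeroʳ L)
      ... | true  | false = sym (*-zeroʳ L)
      ... | true  | true  =
        trans (cong (q ^_) (ArcInsertion.intertwining-insertArc M m c a M≡2m c≤m (s≤s⁻¹ a<1+c)
                                                                σ (isPM⇒IsMatching σ isPMσ) openers))
              (trans (^-distribˡ-+-* q (intertwining σ) _) (*-comm (q ^ intertwining σ) L))

-- The closed form and its recurrence

triangle : ℕ → ℕ
triangle zero    = 0
triangle (suc k) = triangle k + k

triangle≡C2 : ∀ n → triangle n ≡ n C 2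
triangle≡C2 zero    = refl
triangle≡C2 (suc n) =
  trans (cong₂ _+_ (triangle≡C2 n) (sym (nC1≡n n))) (trans (+-comm (n C 2) (n C 1)) (nCk+nC[k+1]≡[n+1]C[k+1] n 1))

product-applyUpTo-suc : ∀ n (g F : ℕ → ℕ) →
  product (map F (applyUpTo g (suc n))) ≡ product (map F (applyUpTo g n)) * F (g n)
product-applyUpTo-suc zero    g F = trans (*-identityʳ (F (g 0))) (sym (*-identityˡ (F (g 0))))
product-applyUpTo-suc (suc n) g F =
  trans (cong (F (g 0) *_) (product-applyUpTo-suc n (g ∘ suc) F)) (sym (*-assoc (F (g 0)) _ _))

module ClosedForm (q : ℕ) where

  [_]q : ℕ → ℕ
  [ k ]q = qInt k q

  qInt-+ : ∀ a b → [ a + b ]q ≡ [ a ]q + q ^ a * [ b ]q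
  qInt-+ a b = begin
    [ a + b ]q                                     ≡⟨ sum-upTo (a + b) (q ^_) ⟩
    sumBelow (a + b) (q ^_)                        ≡⟨ sumBelow-split a b (q ^_) ⟩
    sumBelow a (q ^_) + ∑[ i < b ] (q ^ (a + i))
      ≡⟨ cong₂ _+_ (sym (sum-upTo a (q ^_)))
                   (trans (sumBelow-cong b (λ i _ → ^-distribˡ-+-* q a i)) (sumBelow-*ˡ b (q ^ a) (q ^_))) ⟩
    [ a ]q + q ^ a * sumBelow b (q ^_)             ≡⟨ cong (λ z → [ a ]q + q ^ a * z) (sym (sum-upTo b (q ^_))) ⟩
    [ a ]q + q ^ a * [ b ]q ∎
    where open ≡-Reasoning

  oddProduct : ℕ → ℕ
  oddProduct zero    = 1
  oddProduct (suc j) = oddProduct j * [ suc (2 * j) ]q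

  oddProduct≡qDoubleFact : ∀ n → oddProduct n ≡ qDoubleFact n q
  oddProduct≡qDoubleFact zero    = refl
  oddProduct≡qDoubleFact (suc n) =
    trans (cong (_* [ suc (2 * n) ]q) (oddProduct≡qDoubleFact n))
          (sym (product-applyUpTo-suc n (λ i → i) (λ i → [ suc (2 * i) ]q)))

  risingProduct : ℕ → ℕ → ℕ
  risingProduct j zero    = 1
  risingProduct j (suc h) = risingProduct j h * [ 2 * j + suc h ]q

  closedForm : ℕ → ℕ → ℕ
  closedForm j h = q ^ (triangle (j + h) + triangle h) * (oddProduct j * risingProduct j h)

  risingProduct-suc² : ∀ j c → risingProduct j (suc (suc c)) ≡ [ suc (2 * j) ]q * [ 2 * suc j ]q * risingProduct (suc j) c
  risingProduct-suc² j zero =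
    trans (cong₂ (λ u v → 1 * [ u ]q * [ v ]q) (+-comm (2 * j) 1)
                 (solve 1 (λ j → con 2 :* j :+ con 2 := con 2 :* (con 1 :+ j)) refl j))
          (solve 2 (λ x y → con 1 :* x :* y := x :* y :* con 1) refl [ suc (2 * j) ]q [ 2 * suc j ]q)
  risingProduct-suc² j (suc c) =
    trans (cong (_* [ 2 * j + suc (suc (suc c)) ]q) (risingProduct-suc² j c))
      (trans (cong (λ u → [ suc (2 * j) ]q * [ 2 * suc j ]q * risingProduct (suc j) c * [ u ]q)
                   (solve 2 (λ j c → con 2 :* j :+ (con 3 :+ c) := con 2 :* (con 1 :+ j) :+ (con 1 :+ c)) refl j c))
             (solve 4 (λ x y r z → x :* y :* r :* z := x :* y :* (r :* z)) refl
                [ suc (2 * j) ]q [ 2 * suc j ]q (risingProduct (suc j) c) [ 2 * suc j + suc c ]q))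

  closedForm-suc-0 : ∀ j → closedForm j 1 ≡ closedForm (suc j) 0
  closedForm-suc-0 j =
    cong₂ (λ u w → q ^ (triangle u + 0) * w) (trans (+-comm j 1) (sym (+-identityʳ (suc j))))
      (trans (cong (λ z → oddProduct j * (1 * [ z ]q)) (+-comm (2 * j) 1))
             (solve 2 (λ x y → x :* (con 1 :* y) := x :* y :* con 1) refl (oddProduct j) [ suc (2 * j) ]q))

  closedForm-first-row : ∀ c → closedForm 0 (suc c) ≡ 0 + q ^ (c + (0 + c)) * [ suc c ]q * closedForm 0 c
  closedForm-first-row c = begin
    q ^ (triangle (suc c) + triangle (suc c)) * (1 * (R * [ suc c ]q))
      ≡⟨ cong (λ z → q ^ z * (1 * (R * [ suc c ]q)))
              (solve 2 (λ c t → (t :+ c) :+ (t :+ c) := (c :+ c) :+ (t :+ t)) refl c (triangle c)) ⟩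
    q ^ ((c + c) + (triangle c + triangle c)) * (1 * (R * [ suc c ]q))
      ≡⟨ cong (_* (1 * (R * [ suc c ]q))) (^-distribˡ-+-* q (c + c) (triangle c + triangle c)) ⟩
    q ^ (c + c) * q ^ (triangle c + triangle c) * (1 * (R * [ suc c ]q))
      ≡⟨ solve 4 (λ x t r y → x :* t :* (con 1 :* (r :* y)) := con 0 :+ x :* y :* (t :* (con 1 :* r))) refl
           (q ^ (c + c)) (q ^ (triangle c + triangle c)) R [ suc c ]q ⟩
    0 + q ^ (c + c) * [ suc c ]q * (q ^ (triangle c + triangle c) * (1 * R)) ∎
    where
    open ≡-Reasoning
    R : ℕ
    R = risingProduct 0 c

  -- Uses the q-Pascal step [2 j + c + 3] = [c + 1] + q ^ (c + 1) [2 j + 2].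
  closedForm-recurrence : ∀ j c →
    closedForm (suc j) (suc c) ≡ closedForm j (suc (suc c)) + q ^ (c + (suc j + c)) * [ suc c ]q * closedForm (suc j) c
  closedForm-recurrence j c = begin
    closedForm (suc j) (suc c)
      ≡⟨ cong (λ z → z * (A * B * (E * Z))) (trans (cong (q ^_) (sym e₃+e₄)) (^-distribˡ-+-* q e₃ e₄)) ⟩
    (Q₃ * Q₄) * (A * B * (E * Z))
      ≡⟨ cong (λ z → (Q₃ * Q₄) * (A * B * (E * z))) qPascal ⟩
    (Q₃ * Q₄) * (A * B * (E * (Y + S * X)))
      ≡⟨ solve 8 (λ Q₃ Q₄ S A B E X Y → (Q₃ :* Q₄) :* (A :* B :* (E :* (Y :+ S :* X)))
                  := (Q₃ :* Q₄ :* S) :* (A :* (B :* X :* E)) :+ Q₃ :* Y :* (Q₄ :* (A :* B :* E)))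
           refl Q₃ Q₄ S A B E X Y ⟩
    (Q₃ * Q₄ * S) * (A * (B * X * E)) + Q₃ * Y * (Q₄ * (A * B * E))
      ≡⟨ cong (_+ Q₃ * Y * (Q₄ * (A * B * E))) (sym previous) ⟩
    closedForm j (suc (suc c)) + q ^ (c + (suc j + c)) * [ suc c ]q * closedForm (suc j) c ∎
    where
    open ≡-Reasoning
    A B E Z X Y S e₁ e₃ e₄ Q₃ Q₄ : ℕ
    A = oddProduct j
    B = [ suc (2 * j) ]q
    E = risingProduct (suc j) c
    Z = [ 2 * suc j + suc c ]q
    X = [ 2 * suc j ]q
    Y = [ suc c ]q
    S = q ^ suc c
    e₁ = triangle (suc j + suc c) + triangle (suc c)
    e₃ = c + (suc j + c)
    e₄ = triangle (suc j + c) + triangle c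
    Q₃ = q ^ e₃
    Q₄ = q ^ e₄
    e₃+e₄ : e₃ + e₄ ≡ e₁
    e₃+e₄ = trans (solve 4 (λ c k t₁ t₂ → (c :+ k) :+ (t₁ :+ t₂) := (t₁ :+ k) :+ (t₂ :+ c)) refl
                     c (suc j + c) (triangle (suc j + c)) (triangle c))
                  (cong (λ z → triangle z + triangle (suc c)) (sym (+-suc (suc j) c)))
    qPascal : Z ≡ Y + S * X
    qPascal = trans (cong [_]q (+-comm (2 * suc j) (suc c))) (qInt-+ (suc c) (2 * suc j))
    previous : closedForm j (suc (suc c)) ≡ (Q₃ * Q₄ * S) * (A * (B * X * E))
    previous = cong₂ _*_
      (trans (cong (q ^_) (trans (cong (λ z → triangle z + triangle (suc (suc c))) (+-suc j (suc c)))
                                 (sym (+-assoc (triangle (suc j + suc c)) (triangle (suc c)) (suc c)))))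
             (trans (^-distribˡ-+-* q e₁ (suc c)) (cong (_* S) (trans (cong (q ^_) (sym e₃+e₄)) (^-distribˡ-+-* q e₃ e₄)))))
      (cong (A *_) (risingProduct-suc² j c))

  openerPrefixGF≡closedForm : ∀ j h → openerPrefixGF ((j + h) + (j + h)) h q ≡ closedForm j h
  openerPrefixGF≡closedForm zero    zero    = refl
  openerPrefixGF≡closedForm (suc j) zero    = begin
    openerPrefixGF ((suc j + 0) + (suc j + 0)) 0 q  ≡⟨ openerPrefixGF-0≡1 ((suc j + 0) + (suc j + 0)) q z<s ⟩
    openerPrefixGF ((suc j + 0) + (suc j + 0)) 1 q
      ≡⟨ cong (λ k → openerPrefixGF (k + k) 1 q) (trans (+-identityʳ (suc j)) (+-comm 1 j)) ⟩
    openerPrefixGF ((j + 1) + (j + 1)) 1 q          ≡⟨ openerPrefixGF≡closedForm j 1 ⟩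
    closedForm j 1                                  ≡⟨ closedForm-suc-0 j ⟩
    closedForm (suc j) 0 ∎
    where open ≡-Reasoning
  openerPrefixGF≡closedForm j (suc c) = begin
    openerPrefixGF ((j + suc c) + (j + suc c)) (suc c) q
      ≡⟨ cong (λ N → openerPrefixGF N (suc c) q) N≡ ⟩
    openerPrefixGF (suc (suc M)) (suc c) q
      ≡⟨ openerPrefixGF-suc (suc (suc M)) (suc c) q (s≤s (s≤s c≤M)) ⟩
    openerPrefixGF (suc (suc M)) (suc (suc c)) q
      + sumWhen (firstCloserAt (suc c)) (λ v → q ^ intertwining v) (allVecs (suc (suc M)) (suc (suc M)))
      ≡⟨ cong₂ _+_ (nextColumn j) (FirstCloser.firstCloserGF M m c q refl c≤m) ⟩
    nextClosedForm j + q ^ (c + m) * [ suc c ]q * openerPrefixGF M c q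
      ≡⟨ cong (λ z → nextClosedForm j + q ^ (c + m) * [ suc c ]q * z) (openerPrefixGF≡closedForm j c) ⟩
    nextClosedForm j + q ^ (c + (j + c)) * [ suc c ]q * closedForm j c
      ≡⟨ recurrence j ⟩
    closedForm j (suc c) ∎
    where
    open ≡-Reasoning
    m M : ℕ
    m = j + c
    M = m + m
    c≤m : c ≤ m
    c≤m = m≤n+m c j
    c≤M : c ≤ M
    c≤M = ≤-trans c≤m (m≤m+n m m)
    N≡ : (j + suc c) + (j + suc c) ≡ suc (suc M)
    N≡ = trans (cong (λ k → k + k) (+-suc j c)) (cong suc (+-suc m m))
    nextClosedForm : ℕ → ℕ
    nextClosedForm zero    = 0
    nextClosedForm (suc j) = closedForm j (suc (suc c))
    nextColumn : ∀ j → openerPrefixGF (suc (suc ((j + c) + (j + c)))) (suc (suc c)) q ≡ nextClosedForm j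
    nextColumn zero    =
      trans (cong (λ N → openerPrefixGF N (suc (suc c)) q) (cong suc (sym (+-suc c c))))
            (openerPrefixGF-vanishes (suc c) (suc (suc c)) q ≤-refl)
    nextColumn (suc j) =
      trans (cong (λ N → openerPrefixGF N (suc (suc c)) q)
                  (solve 2 (λ j c → con 2 :+ ((con 1 :+ j :+ c) :+ (con 1 :+ j :+ c))
                                 := (j :+ (con 2 :+ c)) :+ (j :+ (con 2 :+ c))) refl j c))
            (openerPrefixGF≡closedForm j (suc (suc c)))
    recurrence : ∀ j → nextClosedForm j + q ^ (c + (j + c)) * [ suc c ]q * closedForm j c ≡ closedForm j (suc c)
    recurrence zero    = sym (closedForm-first-row c)
    recurrence (suc j) = sym (closedForm-recurrence j c)

mainTheorem7 : (n : ℕ) → 1 ≤ n → (q : ℕ) →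
    pmGenFun (2 * n) q ≡ q ^ (n C 2) * qDoubleFact n q
-- The hypothesis 1 ≤ n is not needed: the case n = 0 reads 1 = 1.
mainTheorem7 n _ q = begin
  pmGenFun (2 * n) q                           ≡⟨ pmGenFun≡openerPrefixGF-0 (2 * n) q ⟩
  openerPrefixGF (2 * n) 0 q                   ≡⟨ cong (λ N → openerPrefixGF N 0 q) 2n≡ ⟩
  openerPrefixGF ((n + 0) + (n + 0)) 0 q       ≡⟨ openerPrefixGF≡closedForm n 0 ⟩
  q ^ (triangle (n + 0) + 0) * (oddProduct n * 1)
    ≡⟨ cong₂ (λ e p → q ^ e * p) (trans (+-identityʳ _) (trans (cong triangle (+-identityʳ n)) (triangle≡C2 n)))
                                  (trans (*-identityʳ (oddProduct n)) (oddProduct≡qDoubleFact n)) ⟩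
  q ^ (n C 2) * qDoubleFact n q ∎
  where
  open ≡-Reasoning
  open ClosedForm q
  2n≡ : 2 * n ≡ (n + 0) + (n + 0)
  2n≡ = cong (_+ (n + 0)) (sym (+-identityʳ n))
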